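{- Let $\Delta$ be a positive integer and let $G$ be a finite simple graph of maximum degree at most $\Delta$ such that no connected component of $G$ has order at most $2$. Then $$\nu_s^*(G) \leq \frac{\Delta}{2\Delta+1}\, n(G),$$ with equality if and only if each connected component of $G$ is isomorphic to $T^*$.
   Context: For a graph $G$, $n(G)$ is its number of vertices. For a vertex $u$, $\delta_G(u)$ is the set of edges incident with $u$; for an edge $uv$, $\delta_G(uv)=\delta_G(u)\cup\delta_G(v)$. The fractional induced matching number $\nu_s^*(G)$ is the optimum value of the linear program: maximize $\sum_{e\in E(G)} x_e$ subject to $\sum_{f\in\delta_G(e)} x_f\le 1$ for every $e\in E(G)$ and $x_e\ge 0$ for every $e\in E(G)$. $T^*$ denotes the tree obtained from the star $K_{1,\Delta}$ (of order $\Delta+1$) by subdividing each edge exactly once. -}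

module Defs where

open import Data.Nat as ℕ using (ℕ; zero; suc; _+_; _<ᵇ_; _≡ᵇ_)
open import Data.Bool using (Bool; true; false; _∧_; _∨_; not)
open import Data.Fin using (Fin; toℕ)
open import Data.List using (List; []; _∷_; map; foldr; filterᵇ; allFin; cartesianProduct; length)
open import Data.Product using (_×_; _,_; proj₁; proj₂; Σ; ∃; ∃-syntax)
open import Data.Integer using (+_)
open import Data.Rational using (ℚ; 0ℚ; 1ℚ; _≤_; _/_) renaming (_+_ to _+ℚ_)
open import Relation.Binary.PropositionalEquality using (_≡_; _≢_)
open import Function.Bundles using (_⇔_)

record Graph : Set where
  field
    n     : ℕ
    adj   : Fin n → Fin n → Bool
    sym   : ∀ u v → adj u v ≡ adj v u
    irrefl : ∀ u → adj u u ≡ false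
open Graph public

_=ᵛ_ : ∀ {m} → Fin m → Fin m → Bool
a =ᵛ b = toℕ a ≡ᵇ toℕ b

edges : (G : Graph) → List (Fin (n G) × Fin (n G))
edges G = filterᵇ (λ p → (toℕ (proj₁ p) <ᵇ toℕ (proj₂ p)) ∧ adj G (proj₁ p) (proj₂ p))
                  (cartesianProduct (allFin (n G)) (allFin (n G)))

deg : (G : Graph) → Fin (n G) → ℕ
deg G u = length (filterᵇ (adj G u) (allFin (n G)))

MaxDegAtMost : Graph → ℕ → Set
MaxDegAtMost G Δ = ∀ u → deg G u ℕ.≤ Δ

data Reach (G : Graph) : Fin (n G) → Fin (n G) → Set where
  here : ∀ {u} → Reach G u u
  step : ∀ {u v w} → adj G u v ≡ true → Reach G v w → Reach G u w

ComponentOrderAtLeast3 : (G : Graph) → Fin (n G) → Set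
ComponentOrderAtLeast3 G v =
  Σ (Fin (n G)) λ a → Σ (Fin (n G)) λ b → Σ (Fin (n G)) λ c →
    a ≢ b × a ≢ c × b ≢ c × Reach G v a × Reach G v b × Reach G v c

NoSmallComponent : Graph → Set
NoSmallComponent G = ∀ v → ComponentOrderAtLeast3 G v

-- Edge weightings; x is read only on the edges of G.
Weighting : Graph → Set
Weighting G = Fin (n G) → Fin (n G) → ℚ

sumℚ : List ℚ → ℚ
sumℚ = foldr _+ℚ_ 0ℚ

incidentᵇ : ∀ {m} → Fin m × Fin m → Fin m × Fin m → Bool
incidentᵇ (a , b) (c , d) = (a =ᵛ c) ∨ (a =ᵛ d) ∨ (b =ᵛ c) ∨ (b =ᵛ d)

δsum : (G : Graph) → Weighting G → Fin (n G) × Fin (n G) → ℚ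
δsum G x e = sumℚ (map (λ f → x (proj₁ f) (proj₂ f)) (filterᵇ (incidentᵇ e) (edges G)))

total : (G : Graph) → Weighting G → ℚ
total G x = sumℚ (map (λ e → x (proj₁ e) (proj₂ e)) (edges G))

Feasible : (G : Graph) → Weighting G → Set
Feasible G x = (∀ e → e Data.List.Membership.Propositional.∈ edges G → 0ℚ ≤ x (proj₁ e) (proj₂ e))
             × (∀ e → e Data.List.Membership.Propositional.∈ edges G → δsum G x e ≤ 1ℚ)
  where import Data.List.Membership.Propositional

IsFracIndMatchingNumber : (G : Graph) → ℚ → Set
IsFracIndMatchingNumber G r =
  (Σ (Weighting G) λ x → Feasible G x × total G x ≡ r)
  × (∀ x → Feasible G x → total G x ≤ r)

-- The tree T* for parameter Δ: vertices 0 (centre), 1..Δ (subdivision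
-- vertices), Δ+1..2Δ (leaves); i ∈ [1,Δ] is adjacent to 0 and to i+Δ.
tstarAdjℕ : ℕ → ℕ → ℕ → Bool
tstarAdjℕ Δ a b =
     ((a ≡ᵇ 0) ∧ (0 <ᵇ b) ∧ (b <ᵇ suc Δ))
  ∨ ((b ≡ᵇ 0) ∧ (0 <ᵇ a) ∧ (a <ᵇ suc Δ))
  ∨ ((0 <ᵇ a) ∧ (a <ᵇ suc Δ) ∧ (b ≡ᵇ a + Δ))
  ∨ ((0 <ᵇ b) ∧ (b <ᵇ suc Δ) ∧ (a ≡ᵇ b + Δ))

tstarOrder : ℕ → ℕ
tstarOrder Δ = suc (Δ + Δ)

ComponentIso : (G : Graph) → Fin (n G) → (k : ℕ) → (Fin k → Fin k → Bool) → Set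
ComponentIso G v k adjH =
  Σ (Fin k → Fin (n G)) λ f →
      (∀ a b → f a ≡ f b → a ≡ b)
    × (∀ u → Reach G v u ⇔ (∃[ a ] f a ≡ u))
    × (∀ a b → adj G (f a) (f b) ≡ adjH a b)

ComponentIsoTstar : (Δ : ℕ) (G : Graph) → Fin (n G) → Set
ComponentIsoTstar Δ G v =
  ComponentIso G v (tstarOrder Δ) (λ a b → tstarAdjℕ Δ (toℕ a) (toℕ b))

AllComponentsTstar : ℕ → Graph → Set
AllComponentsTstar Δ G = ∀ v → ComponentIsoTstar Δ G v

bound : ℕ → Graph → ℚ
bound Δ G = (+ Δ / suc (Δ + Δ)) Data.Rational.* (+ n G / 1)

module Submission where

-- Give every vertex u the weight w(u) = Δ / deg u, which is at least 1. For a feasible x,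
-- count the constraint of every edge uv once from each endpoint u, with weight w(u): the
-- total is at most Σ_u w(u) deg u = Δ·n. Exchanging the order of summation, an edge ab is
-- counted with its load, the sum of w(u) over the arcs (u , v) meeting ab. Its endpoints
-- contribute Δ each and a further vertex of its component at least 1, so every load is at
-- least 2Δ + 1 and (2Δ + 1)·Σ x ≤ Δ·n.
--
-- At equality every constraint is tight and every edge of positive weight has load exactly
-- 2Δ + 1, which forces it to be the end ℓm of a pendant path ℓ–m–c with deg c = Δ. The tight
-- constraints then leave no weight on the other edges at c, and every component turns out to
-- be a spider with Δ legs of length two, that is, a copy of T*. Conversely, on such a graph
-- the weighting that is 1 on the pendant edges makes every constraint tight and loads only
-- edges of load 2Δ + 1, so it attains the bound.

open import Data.Nat as ℕ using (ℕ; zero; suc)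
import Data.Nat.Properties as ℕₚ
open import Data.Fin as Fin using (Fin; zero; suc; toℕ)
import Data.Fin.Properties as Finₚ
open import Data.Bool using (Bool; true; false; T; if_then_else_; _∧_; _∨_)
import Data.Bool.Properties as Boolₚ
open import Data.Product using (_×_; _,_; proj₁; proj₂; Σ; ∃-syntax; uncurry)
open import Data.Sum using (_⊎_; inj₁; inj₂)
open import Data.Empty using (⊥; ⊥-elim)
open import Data.List using (List; []; _∷_)
open import Data.Rational as ℚ using (ℚ; 0ℚ; 1ℚ; _+_; _*_)
import Data.Rational.Properties as ℚₚ
open import Relation.Binary.PropositionalEquality
open import Relation.Nullary using (¬_; yes; no; does)
open import Function using (_∘_)
open import Defs hiding (sym)

module Rationals where
  open import Data.Integer as ℤ using ()
  open import Data.Rational using (_≤_; _<_; _/_; -_; toℚᵘ)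
  import Data.Rational.Unnormalised as ℚᵘ
  import Data.Rational.Unnormalised.Properties as ℚᵘₚ
  import Data.Integer.Solver as ℤ-Solver
  open import Data.Rational.Solver using (module +-*-Solver)

  ℕ→ℚ : ℕ → ℚ
  ℕ→ℚ k = ℤ.+ k / 1

  ℕ→ℚ-zero : ℕ→ℚ 0 ≡ 0ℚ
  ℕ→ℚ-zero = ℚₚ.0/n≡0 1

  -- Identities involving _/_ are checked in ℚᵘ, where they reduce to cross-multiplication.
  ℕ→ℚ-suc : ∀ k → ℕ→ℚ (suc k) ≡ 1ℚ + ℕ→ℚ k
  ℕ→ℚ-suc k = ℚₚ.toℚᵘ-injective
    (ℚᵘₚ.≃-trans (ℚₚ.toℚᵘ-fromℚᵘ (ℚᵘ.mkℚᵘ (ℤ.+ suc k) 0))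
    (ℚᵘₚ.≃-trans (ℚᵘ.*≡* cross)
    (ℚᵘₚ.≃-sym (ℚᵘₚ.≃-trans (ℚₚ.toℚᵘ-homo-+ 1ℚ (ℕ→ℚ k))
                            (ℚᵘₚ.+-congʳ (toℚᵘ 1ℚ) (ℚₚ.toℚᵘ-fromℚᵘ (ℚᵘ.mkℚᵘ (ℤ.+ k) 0)))))))
    where
    open ℤ-Solver.+-*-Solver
    cross : ℤ.+ suc k ℤ.* ℚᵘ.↧ (toℚᵘ 1ℚ ℚᵘ.+ ℚᵘ.mkℚᵘ (ℤ.+ k) 0) ≡ ℚᵘ.↥ (toℚᵘ 1ℚ ℚᵘ.+ ℚᵘ.mkℚᵘ (ℤ.+ k) 0) ℤ.* ℤ.+ 1
    cross = solve 1 (λ K → (con (ℤ.+ 1) :+ K) :* (con (ℤ.+ 1) :* con (ℤ.+ 1))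
                         := (con (ℤ.+ 1) :* con (ℤ.+ 1) :+ K :* con (ℤ.+ 1)) :* con (ℤ.+ 1)) refl (ℤ.+ k)

  ℕ→ℚ-*-/ : ∀ a d → ℕ→ℚ (suc d) * (ℤ.+ a / suc d) ≡ ℕ→ℚ a
  ℕ→ℚ-*-/ a d = ℚₚ.toℚᵘ-injective
    (ℚᵘₚ.≃-trans (ℚₚ.toℚᵘ-homo-* (ℕ→ℚ (suc d)) (ℤ.+ a / suc d))
    (ℚᵘₚ.≃-trans (ℚᵘₚ.*-cong (ℚₚ.toℚᵘ-fromℚᵘ (ℚᵘ.mkℚᵘ (ℤ.+ suc d) 0)) (ℚₚ.toℚᵘ-fromℚᵘ (ℚᵘ.mkℚᵘ (ℤ.+ a) d)))
    (ℚᵘₚ.≃-trans (ℚᵘ.*≡* cross) (ℚᵘₚ.≃-sym (ℚₚ.toℚᵘ-fromℚᵘ (ℚᵘ.mkℚᵘ (ℤ.+ a) 0))))))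
    where
    open ℤ-Solver.+-*-Solver
    cross : ℚᵘ.↥ (ℚᵘ.mkℚᵘ (ℤ.+ suc d) 0 ℚᵘ.* ℚᵘ.mkℚᵘ (ℤ.+ a) d) ℤ.* ℤ.+ 1
          ≡ ℤ.+ a ℤ.* ℚᵘ.↧ (ℚᵘ.mkℚᵘ (ℤ.+ suc d) 0 ℚᵘ.* ℚᵘ.mkℚᵘ (ℤ.+ a) d)
    cross = solve 2 (λ A D → (D :* A) :* con (ℤ.+ 1) := A :* (con (ℤ.+ 1) :* D)) refl (ℤ.+ a) (ℤ.+ suc d)

  ℕ→ℚ-one : ℕ→ℚ 1 ≡ 1ℚ
  ℕ→ℚ-one = trans (ℕ→ℚ-suc 0) (trans (cong (1ℚ +_) ℕ→ℚ-zero) (ℚₚ.+-identityʳ 1ℚ))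

  ℕ→ℚ-+ : ∀ a b → ℕ→ℚ (a ℕ.+ b) ≡ ℕ→ℚ a + ℕ→ℚ b
  ℕ→ℚ-+ zero    b = sym (trans (cong (_+ ℕ→ℚ b) ℕ→ℚ-zero) (ℚₚ.+-identityˡ _))
  ℕ→ℚ-+ (suc a) b = begin
    ℕ→ℚ (suc (a ℕ.+ b))         ≡⟨ ℕ→ℚ-suc (a ℕ.+ b) ⟩
    1ℚ + ℕ→ℚ (a ℕ.+ b)          ≡⟨ cong (1ℚ +_) (ℕ→ℚ-+ a b) ⟩
    1ℚ + (ℕ→ℚ a + ℕ→ℚ b)        ≡⟨ ℚₚ.+-assoc 1ℚ (ℕ→ℚ a) (ℕ→ℚ b) ⟨
    1ℚ + ℕ→ℚ a + ℕ→ℚ b          ≡⟨ cong (_+ ℕ→ℚ b) (ℕ→ℚ-suc a) ⟨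
    ℕ→ℚ (suc a) + ℕ→ℚ b         ∎
    where open ≡-Reasoning

  0<1 : 0ℚ < 1ℚ
  0<1 = ℚₚ.positive⁻¹ 1ℚ

  0≤1 : 0ℚ ≤ 1ℚ
  0≤1 = ℚₚ.<⇒≤ 0<1

  p≤p+q : ∀ {p q} → 0ℚ ≤ q → p ≤ p + q
  p≤p+q {p} {q} 0≤q = subst (_≤ p + q) (ℚₚ.+-identityʳ p) (ℚₚ.+-monoʳ-≤ p 0≤q)

  p≤q+p : ∀ {p q} → 0ℚ ≤ q → p ≤ q + p
  p≤q+p {p} {q} 0≤q = subst (p ≤_) (ℚₚ.+-comm p q) (p≤p+q 0≤q)

  +-cancelʳ-≤ : ∀ {p q r} → p + r ≤ q + r → p ≤ q
  +-cancelʳ-≤ {p} {q} {r} h = subst₂ _≤_ (cancel p) (cancel q) (ℚₚ.+-monoˡ-≤ (- r) h)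
    where
    open +-*-Solver
    cancel : ∀ x → x + r + - r ≡ x
    cancel x = solve 2 (λ X R → X :+ R :+ :- R := X) refl x r

  +-cancelˡ-≤ : ∀ {p q r} → r + p ≤ r + q → p ≤ q
  +-cancelˡ-≤ {p} {q} {r} h = +-cancelʳ-≤ (subst₂ _≤_ (ℚₚ.+-comm r p) (ℚₚ.+-comm r q) h)

  *-nonNeg : ∀ {p q} → 0ℚ ≤ p → 0ℚ ≤ q → 0ℚ ≤ p * q
  *-nonNeg {p} {q} 0≤p 0≤q = subst (_≤ p * q) (ℚₚ.*-zeroˡ q) (ℚₚ.*-monoʳ-≤-nonNeg q {{ℚ.nonNegative 0≤q}} 0≤p)

  *-monoˡ-≤ : ∀ {r p q} → 0ℚ ≤ r → p ≤ q → r * p ≤ r * q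
  *-monoˡ-≤ {r} 0≤r = ℚₚ.*-monoˡ-≤-nonNeg r {{ℚ.nonNegative 0≤r}}

  *-cancelˡ-≤ : ∀ {r p q} → 0ℚ < r → r * p ≤ r * q → p ≤ q
  *-cancelˡ-≤ {r} 0<r = ℚₚ.*-cancelˡ-≤-pos r {{ℚ.positive 0<r}}

  *-cancelˡ-≡ : ∀ {r p q} → 0ℚ < r → r * p ≡ r * q → p ≡ q
  *-cancelˡ-≡ 0<r e = ℚₚ.≤-antisym (*-cancelˡ-≤ 0<r (ℚₚ.≤-reflexive e)) (*-cancelˡ-≤ 0<r (ℚₚ.≤-reflexive (sym e)))

  ℕ→ℚ-nonNeg : ∀ k → 0ℚ ≤ ℕ→ℚ k
  ℕ→ℚ-nonNeg zero    = ℚₚ.≤-reflexive (sym ℕ→ℚ-zero)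
  ℕ→ℚ-nonNeg (suc k) = subst (0ℚ ≤_) (sym (ℕ→ℚ-suc k)) (ℚₚ.≤-trans (ℕ→ℚ-nonNeg k) (p≤q+p 0≤1))

  ℕ→ℚ-pos : ∀ k → 0ℚ < ℕ→ℚ (suc k)
  ℕ→ℚ-pos k = subst (0ℚ <_) (sym (ℕ→ℚ-suc k)) (ℚₚ.<-≤-trans 0<1 (p≤p+q (ℕ→ℚ-nonNeg k)))

  ℕ→ℚ-mono-≤ : ∀ {a b} → a ℕ.≤ b → ℕ→ℚ a ≤ ℕ→ℚ b
  ℕ→ℚ-mono-≤ {a} {b} a≤b = subst (ℕ→ℚ a ≤_) (trans (sym (ℕ→ℚ-+ a (b ℕ.∸ a))) (cong ℕ→ℚ (ℕₚ.m+[n∸m]≡n a≤b)))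
    (p≤p+q (ℕ→ℚ-nonNeg (b ℕ.∸ a)))

  ℕ→ℚ-mono-< : ∀ {a b} → a ℕ.< b → ℕ→ℚ a < ℕ→ℚ b
  ℕ→ℚ-mono-< {a} {suc b} (ℕ.s≤s a≤b) = ℚₚ.≤-<-trans (ℕ→ℚ-mono-≤ a≤b)
    (subst (ℕ→ℚ b <_) (sym (ℕ→ℚ-suc b)) (subst (_< 1ℚ + ℕ→ℚ b) (ℚₚ.+-identityˡ (ℕ→ℚ b)) (ℚₚ.+-monoˡ-< (ℕ→ℚ b) 0<1)))

  ℕ→ℚ-cancel-≤ : ∀ {a b} → ℕ→ℚ a ≤ ℕ→ℚ b → a ℕ.≤ b
  ℕ→ℚ-cancel-≤ {a} {b} h with a ℕ.≤? b
  ... | yes a≤b = a≤b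
  ... | no  a≰b = ⊥-elim (ℚₚ.<-irrefl refl (ℚₚ.≤-<-trans h (ℕ→ℚ-mono-< (ℕₚ.≰⇒> a≰b))))

  ℕ→ℚ-injective : ∀ {a b} → ℕ→ℚ a ≡ ℕ→ℚ b → a ≡ b
  ℕ→ℚ-injective e = ℕₚ.≤-antisym (ℕ→ℚ-cancel-≤ (ℚₚ.≤-reflexive e)) (ℕ→ℚ-cancel-≤ (ℚₚ.≤-reflexive (sym e)))

  -- a ÷ 0 is a junk value; it is only ever taken at positive degrees.
  _÷_ : ℕ → ℕ → ℚ
  a ÷ zero  = 0ℚ
  a ÷ suc d = ℤ.+ a / suc d

  ÷-*-cancel : ∀ a d → (a ÷ suc d) * ℕ→ℚ (suc d) ≡ ℕ→ℚ a
  ÷-*-cancel a d = trans (ℚₚ.*-comm (a ÷ suc d) (ℕ→ℚ (suc d))) (ℕ→ℚ-*-/ a d)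

  1≤÷ : ∀ {a d} → suc d ℕ.≤ a → 1ℚ ≤ a ÷ suc d
  1≤÷ {a} {d} d<a = ℚₚ.*-cancelʳ-≤-pos (ℕ→ℚ (suc d)) {{ℚ.positive (ℕ→ℚ-pos d)}}
    (subst₂ _≤_ (sym (ℚₚ.*-identityˡ _)) (sym (÷-*-cancel a d)) (ℕ→ℚ-mono-≤ d<a))

  ÷≤1⇒≤ : ∀ {a d} → a ÷ suc d ≤ 1ℚ → a ℕ.≤ suc d
  ÷≤1⇒≤ {a} {d} h = ℕ→ℚ-cancel-≤ (subst₂ _≤_ (÷-*-cancel a d) (ℚₚ.*-identityˡ _)
    (ℚₚ.*-monoʳ-≤-nonNeg (ℕ→ℚ (suc d)) {{ℚ.nonNegative (ℕ→ℚ-nonNeg (suc d))}} h))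

  n÷n≡1 : ∀ d → suc d ÷ suc d ≡ 1ℚ
  n÷n≡1 d = *-cancelˡ-≡ (ℕ→ℚ-pos d) (trans (ℕ→ℚ-*-/ (suc d) d) (sym (ℚₚ.*-identityʳ _)))

  2ℚ : ℚ
  2ℚ = 1ℚ + 1ℚ

  0<2 : 0ℚ < 2ℚ
  0<2 = ℚₚ.<-≤-trans 0<1 (p≤p+q 0≤1)

  2*p≡p+p : ∀ p → 2ℚ * p ≡ p + p
  2*p≡p+p p = trans (ℚₚ.*-distribʳ-+ p 1ℚ 1ℚ) (cong₂ _+_ (ℚₚ.*-identityˡ p) (ℚₚ.*-identityˡ p))

  squeeze : ∀ {p q r} → p ≤ q → q ≤ r → p ≡ r → p ≡ q × q ≡ r
  squeeze p≤q q≤r refl = ℚₚ.≤-antisym p≤q q≤r , ℚₚ.≤-antisym q≤r p≤q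

  2≰1 : ¬ (2ℚ ≤ 1ℚ)
  2≰1 2≤1 = ℚₚ.<-irrefl refl (ℚₚ.<-≤-trans 0<1 (+-cancelʳ-≤ {1ℚ} {0ℚ} {1ℚ} (subst (2ℚ ≤_) (sym (ℚₚ.+-identityˡ 1ℚ)) 2≤1)))


open Rationals

module FiniteSums where
  open import Data.Rational using (_≤_; _<_)
  open import Data.List using (map; filterᵇ; allFin; cartesianProduct; length; tabulate; _++_; lookup)
  open import Data.List.Relation.Unary.Unique.Propositional using (Unique)
  import Data.List.Relation.Unary.Unique.Propositional.Properties as Uniqueₚ
  import Data.List.Relation.Unary.Any as Any
  import Data.List.Relation.Unary.Any.Properties as Anyₚ
  open import Data.List.Membership.Propositional.Properties using (∈-filter⁺; ∈-filter⁻; ∈-allFin; ∈-lookup)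
  open import Data.Bool.Properties using (T?)
  open import Function using (Equivalence)
  open import Data.List.Membership.Propositional using (_∈_)
  open import Data.List.Relation.Unary.Any using (here; there)
  open import Data.List.Relation.Unary.All as All using (All; []; _∷_)
  open import Data.List.Relation.Unary.AllPairs using (AllPairs; []; _∷_)
  open import Data.Product using (curry)
  open import Data.Product.Properties using (≡-dec)
  open import Algebra.Bundles using (CommutativeRing)
  open import Relation.Binary.Definitions using (DecidableEquality; tri<; tri≈; tri>)
  open import Relation.Nullary.Decidable using (dec-true; dec-false)
  open import Algebra.Properties.Semiring.Sum (CommutativeRing.semiring ℚₚ.+-*-commutativeRing) public
    using (sum; sum-syntax; sum-cong-≗; sum-replicate-zero; ∑-distrib-+; ∑-comm; *-distribˡ-sum)

  ∑ₗ : ∀ {A : Set} → (A → ℚ) → List A → ℚ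
  ∑ₗ f xs = sumℚ (map f xs)

  ∑ₗ-cong : ∀ {A : Set} {f g : A → ℚ} → (∀ a → f a ≡ g a) → ∀ xs → ∑ₗ f xs ≡ ∑ₗ g xs
  ∑ₗ-cong f≗g []       = refl
  ∑ₗ-cong f≗g (x ∷ xs) = cong₂ _+_ (f≗g x) (∑ₗ-cong f≗g xs)

  ∑ₗ-congᴬ : ∀ {A : Set} {f g : A → ℚ} {xs} → All (λ a → f a ≡ g a) xs → ∑ₗ f xs ≡ ∑ₗ g xs
  ∑ₗ-congᴬ []           = refl
  ∑ₗ-congᴬ (e ∷ es) = cong₂ _+_ e (∑ₗ-congᴬ es)

  ∑ₗ-mono-≤ : ∀ {A : Set} {f g : A → ℚ} → (∀ a → f a ≤ g a) → ∀ xs → ∑ₗ f xs ≤ ∑ₗ g xs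
  ∑ₗ-mono-≤ f≤g []       = ℚₚ.≤-refl
  ∑ₗ-mono-≤ f≤g (x ∷ xs) = ℚₚ.+-mono-≤ (f≤g x) (∑ₗ-mono-≤ f≤g xs)

  ∑ₗ-++ : ∀ {A : Set} (f : A → ℚ) xs ys → ∑ₗ f (xs ++ ys) ≡ ∑ₗ f xs + ∑ₗ f ys
  ∑ₗ-++ f []       ys = sym (ℚₚ.+-identityˡ _)
  ∑ₗ-++ f (x ∷ xs) ys = trans (cong (f x +_) (∑ₗ-++ f xs ys)) (sym (ℚₚ.+-assoc (f x) _ _))

  ∑ₗ-map : ∀ {A B : Set} (f : B → ℚ) (g : A → B) xs → ∑ₗ f (map g xs) ≡ ∑ₗ (f ∘ g) xs
  ∑ₗ-map f g []       = refl
  ∑ₗ-map f g (x ∷ xs) = cong (f (g x) +_) (∑ₗ-map f g xs)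

  ∑ₗ-filterᵇ : ∀ {A : Set} (f : A → ℚ) (p : A → Bool) xs →
               ∑ₗ f (filterᵇ p xs) ≡ ∑ₗ (λ a → if p a then f a else 0ℚ) xs
  ∑ₗ-filterᵇ f p []       = refl
  ∑ₗ-filterᵇ f p (x ∷ xs) with p x
  ... | true  = cong (f x +_) (∑ₗ-filterᵇ f p xs)
  ... | false = trans (∑ₗ-filterᵇ f p xs) (sym (ℚₚ.+-identityˡ _))

  ∑ₗ-cartesianProduct : ∀ {A B : Set} (f : A × B → ℚ) xs ys →
                        ∑ₗ f (cartesianProduct xs ys) ≡ ∑ₗ (λ a → ∑ₗ (λ b → f (a , b)) ys) xs
  ∑ₗ-cartesianProduct f []       ys = refl
  ∑ₗ-cartesianProduct f (x ∷ xs) ys =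
    trans (∑ₗ-++ f (map (x ,_) ys) _) (cong₂ _+_ (∑ₗ-map f (x ,_) ys) (∑ₗ-cartesianProduct f xs ys))

  ∑ₗ-tabulate : ∀ {A : Set} n (f : A → ℚ) (g : Fin n → A) → ∑ₗ f (tabulate g) ≡ ∑[ i < n ] f (g i)
  ∑ₗ-tabulate zero    f g = refl
  ∑ₗ-tabulate (suc n) f g = cong (f (g zero) +_) (∑ₗ-tabulate n f (g ∘ suc))

  ∑ₗ-allFin : ∀ n (f : Fin n → ℚ) → ∑ₗ f (allFin n) ≡ sum f
  ∑ₗ-allFin n f = ∑ₗ-tabulate n f (λ i → i)

  ℕ→ℚ-length : ∀ {A : Set} (xs : List A) → ℕ→ℚ (length xs) ≡ ∑ₗ (λ _ → 1ℚ) xs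
  ℕ→ℚ-length []       = ℕ→ℚ-zero
  ℕ→ℚ-length (x ∷ xs) = trans (ℕ→ℚ-suc (length xs)) (cong (1ℚ +_) (ℕ→ℚ-length xs))

  𝟙 : Bool → ℚ
  𝟙 b = if b then 1ℚ else 0ℚ

  𝟙-nonNeg : ∀ b → 0ℚ ≤ 𝟙 b
  𝟙-nonNeg true  = 0≤1
  𝟙-nonNeg false = ℚₚ.≤-refl

  count : ∀ n → (Fin n → Bool) → ℕ
  count n p = length (filterᵇ p (allFin n))

  ℕ→ℚ-count : ∀ n (p : Fin n → Bool) → ℕ→ℚ (count n p) ≡ ∑[ i < n ] 𝟙 (p i)
  ℕ→ℚ-count n p = trans (ℕ→ℚ-length (filterᵇ p (allFin n)))
    (trans (∑ₗ-filterᵇ (λ _ → 1ℚ) p (allFin n)) (∑ₗ-allFin n _))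

  sum-mono-≤ : ∀ {n} {f g : Fin n → ℚ} → (∀ i → f i ≤ g i) → sum f ≤ sum g
  sum-mono-≤ {zero}  f≤g = ℚₚ.≤-refl
  sum-mono-≤ {suc n} f≤g = ℚₚ.+-mono-≤ (f≤g zero) (sum-mono-≤ (f≤g ∘ suc))

  sum-δ : ∀ {n} (k : Fin n) c → ∑[ i < n ] (if does (i Fin.≟ k) then c else 0ℚ) ≡ c
  sum-δ {suc n} zero    c = trans (cong (c +_) (sum-replicate-zero n)) (ℚₚ.+-identityʳ c)
  sum-δ {suc n} (suc k) c = trans (ℚₚ.+-identityˡ _) (sum-δ k c)

  sum-const : ∀ n c → ∑[ i < n ] c ≡ ℕ→ℚ n * c
  sum-const zero    c = sym (trans (cong (_* c) ℕ→ℚ-zero) (ℚₚ.*-zeroˡ c))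
  sum-const (suc n) c = begin
    c + ∑[ i < n ] c           ≡⟨ cong (c +_) (sum-const n c) ⟩
    c + ℕ→ℚ n * c              ≡⟨ cong (_+ ℕ→ℚ n * c) (ℚₚ.*-identityˡ c) ⟨
    1ℚ * c + ℕ→ℚ n * c         ≡⟨ ℚₚ.*-distribʳ-+ c 1ℚ (ℕ→ℚ n) ⟨
    (1ℚ + ℕ→ℚ n) * c           ≡⟨ cong (_* c) (ℕ→ℚ-suc n) ⟨
    ℕ→ℚ (suc n) * c            ∎
    where open ≡-Reasoning

  sum-pos : ∀ {n} {f : Fin n → ℚ} → 0ℚ < sum f → ∃[ i ] 0ℚ < f i
  sum-pos {zero}  0<0 = ⊥-elim (ℚₚ.<-irrefl refl 0<0)
  sum-pos {suc n} {f} 0<∑ with 0ℚ ℚₚ.<? f zero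
  ... | yes 0<f₀ = zero , 0<f₀
  ... | no  0≮f₀ = let (i , 0<fᵢ) = sum-pos {f = f ∘ suc} (ℚₚ.<-≤-trans 0<∑ f₀+∑≤∑) in suc i , 0<fᵢ
    where
    f₀+∑≤∑ : f zero + sum (f ∘ suc) ≤ sum (f ∘ suc)
    f₀+∑≤∑ = subst (f zero + sum (f ∘ suc) ≤_) (ℚₚ.+-identityˡ _) (ℚₚ.+-monoˡ-≤ (sum (f ∘ suc)) (ℚₚ.≮⇒≥ 0≮f₀))

  ∑∑ : ∀ {n} → (Fin n → Fin n → ℚ) → ℚ
  ∑∑ {n} h = ∑[ a < n ] ∑[ b < n ] h a b

  ∑∑-cong : ∀ {n} {g h : Fin n → Fin n → ℚ} → (∀ a b → g a b ≡ h a b) → ∑∑ g ≡ ∑∑ h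
  ∑∑-cong g≗h = sum-cong-≗ (λ a → sum-cong-≗ (g≗h a))

  ∑∑-+ : ∀ {n} (g h : Fin n → Fin n → ℚ) → ∑∑ (λ a b → g a b + h a b) ≡ ∑∑ g + ∑∑ h
  ∑∑-+ g h = trans (sum-cong-≗ (λ a → ∑-distrib-+ (g a) (h a))) (∑-distrib-+ (λ a → sum (g a)) (λ a → sum (h a)))

  ∑∑-mono-≤ : ∀ {n} {g h : Fin n → Fin n → ℚ} → (∀ a b → g a b ≤ h a b) → ∑∑ g ≤ ∑∑ h
  ∑∑-mono-≤ g≤h = sum-mono-≤ (λ a → sum-mono-≤ (g≤h a))

  ∑∑-*ˡ : ∀ {n} c (h : Fin n → Fin n → ℚ) → c * ∑∑ h ≡ ∑∑ (λ a b → c * h a b)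
  ∑∑-*ˡ c h = trans (*-distribˡ-sum c (λ a → sum (h a))) (sum-cong-≗ (λ a → *-distribˡ-sum c (h a)))

  ∑∑-pos : ∀ {n} {h : Fin n → Fin n → ℚ} → 0ℚ < ∑∑ h → ∃[ a ] ∃[ b ] 0ℚ < h a b
  ∑∑-pos 0<∑∑ = let (a , 0<∑) = sum-pos 0<∑∑ ; (b , 0<h) = sum-pos 0<∑ in a , b , 0<h

  ∑∑-comm : ∀ {n} (F : Fin n → Fin n → Fin n → Fin n → ℚ) →
            ∑∑ (λ u v → ∑∑ (F u v)) ≡ ∑∑ (λ a b → ∑∑ (λ u v → F u v a b))
  ∑∑-comm {n} F = trans (sum-cong-≗ (λ u → ∑-comm (λ v a → sum (F u v a))))
    (trans (∑-comm (λ u a → ∑[ v < n ] sum (F u v a)))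
    (sum-cong-≗ (λ a → trans (sum-cong-≗ (λ u → ∑-comm (λ v b → F u v a b))) (∑-comm (λ u b → ∑[ v < n ] F u v a b)))))

  if-∑ : ∀ {n} (c : Bool) (f : Fin n → ℚ) → (if c then sum f else 0ℚ) ≡ ∑[ i < n ] (if c then f i else 0ℚ)
  if-∑ true  f = refl
  if-∑ {n} false f = sym (sum-replicate-zero n)

  ≢-fst : ∀ {A B : Set} {a c : A} {b d : B} → a ≢ c → (a , b) ≢ (c , d)
  ≢-fst a≢c = a≢c ∘ cong proj₁

  ≢-snd : ∀ {A B : Set} {a c : A} {b d : B} → b ≢ d → (a , b) ≢ (c , d)
  ≢-snd b≢d = b≢d ∘ cong proj₂

  -- Finite sums with point evaluation, abstracted so that the bounds below serve both for sums
  -- over vertices and for sums over ordered pairs of vertices.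
  record Summation (I : Set) : Set where
    field
      _≟_      : DecidableEquality I
      ∑        : (I → ℚ) → ℚ
      ∑-cong   : ∀ {f g} → (∀ i → f i ≡ g i) → ∑ f ≡ ∑ g
      ∑-zero   : ∑ (λ _ → 0ℚ) ≡ 0ℚ
      ∑-+      : ∀ f g → ∑ (λ i → f i + g i) ≡ ∑ f + ∑ g
      ∑-mono-≤ : ∀ {f g} → (∀ i → f i ≤ g i) → ∑ f ≤ ∑ g
      ∑-δ      : ∀ k c → ∑ (λ i → if does (i ≟ k) then c else 0ℚ) ≡ c

  finSummation : ∀ n → Summation (Fin n)
  finSummation n = record
    { _≟_ = Fin._≟_ ; ∑ = sum ; ∑-cong = sum-cong-≗ ; ∑-zero = sum-replicate-zero n
    ; ∑-+ = ∑-distrib-+ ; ∑-mono-≤ = sum-mono-≤ ; ∑-δ = sum-δ }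

  pairSummation : ∀ n → Summation (Fin n × Fin n)
  pairSummation n = record
    { _≟_ = _≟₂_ ; ∑ = ∑∑ ∘ curry ; ∑-cong = λ f≗g → ∑∑-cong (curry f≗g)
    ; ∑-zero = trans (sum-cong-≗ {n} (λ _ → sum-replicate-zero n)) (sum-replicate-zero n)
    ; ∑-+ = λ f g → ∑∑-+ (curry f) (curry g) ; ∑-mono-≤ = λ f≤g → ∑∑-mono-≤ (curry f≤g)
    ; ∑-δ = δ₂ }
    where
    _≟₂_ : DecidableEquality (Fin n × Fin n)
    _≟₂_ = ≡-dec Fin._≟_ Fin._≟_
    δ-factor : ∀ p q c a b → (if does ((a , b) ≟₂ (p , q)) then c else 0ℚ)
                           ≡ (if does (a Fin.≟ p) then (if does (b Fin.≟ q) then c else 0ℚ) else 0ℚ)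
    δ-factor p q c a b with (a , b) ≟₂ (p , q)
    ... | yes refl = sym (cong₂ (λ s t → if s then (if t then c else 0ℚ) else 0ℚ)
                                (dec-true (a Fin.≟ a) refl) (dec-true (b Fin.≟ b) refl))
    ... | no ab≢pq with a Fin.≟ p | b Fin.≟ q
    ...   | yes refl | yes refl = ⊥-elim (ab≢pq refl)
    ...   | yes refl | no _     = refl
    ...   | no _     | _        = refl
    δ₂ : ∀ k c → ∑∑ (curry (λ i → if does (i ≟₂ k) then c else 0ℚ)) ≡ c
    δ₂ (p , q) c = begin
      ∑∑ (λ a b → if does ((a , b) ≟₂ (p , q)) then c else 0ℚ)                     ≡⟨ ∑∑-cong (δ-factor p q c) ⟩
      ∑[ a < n ] ∑[ b < n ] (if does (a Fin.≟ p) then (if does (b Fin.≟ q) then c else 0ℚ) else 0ℚ)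
        ≡⟨ sum-cong-≗ (λ a → if-∑ (does (a Fin.≟ p)) (λ b → if does (b Fin.≟ q) then c else 0ℚ)) ⟨
      ∑[ a < n ] (if does (a Fin.≟ p) then ∑[ b < n ] (if does (b Fin.≟ q) then c else 0ℚ) else 0ℚ)
                                                                                    ≡⟨ sum-δ p _ ⟩
      ∑[ b < n ] (if does (b Fin.≟ q) then c else 0ℚ)                              ≡⟨ sum-δ q c ⟩
      c                                                                             ∎
      where open ≡-Reasoning

  module SummationProperties {I : Set} (S : Summation I) where
    open Summation S

    erase : I → (I → ℚ) → I → ℚ
    erase k f i = if does (i ≟ k) then 0ℚ else f i

    erase-self : ∀ k f → erase k f k ≡ 0ℚ
    erase-self k f = cong (λ t → if t then 0ℚ else f k) (dec-true (k ≟ k) refl)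

    erase-other : ∀ {k i} f → i ≢ k → erase k f i ≡ f i
    erase-other {k} {i} f i≢k = cong (λ t → if t then 0ℚ else f i) (dec-false (i ≟ k) i≢k)

    erase-mono-≤ : ∀ k {f g} → (∀ i → f i ≤ g i) → ∀ i → erase k f i ≤ erase k g i
    erase-mono-≤ k {f} {g} f≤g i with i ≟ k
    ... | yes _ = ℚₚ.≤-refl
    ... | no  _ = f≤g i

    erase-≤ : ∀ k {f} → (∀ i → 0ℚ ≤ f i) → ∀ i → erase k f i ≤ f i
    erase-≤ k {f} f≥0 i with i ≟ k
    ... | yes _ = f≥0 i
    ... | no  _ = ℚₚ.≤-refl

    erase-nonNeg : ∀ k {f} → (∀ i → 0ℚ ≤ f i) → ∀ i → 0ℚ ≤ erase k f i
    erase-nonNeg k f≥0 i with i ≟ k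
    ... | yes _ = ℚₚ.≤-refl
    ... | no  _ = f≥0 i

    ∑-nonNeg : ∀ {f} → (∀ i → 0ℚ ≤ f i) → 0ℚ ≤ ∑ f
    ∑-nonNeg {f} f≥0 = subst (_≤ ∑ f) ∑-zero (∑-mono-≤ f≥0)

    ∑-split : ∀ f k → ∑ f ≡ f k + ∑ (erase k f)
    ∑-split f k = begin
      ∑ f                                                          ≡⟨ ∑-cong split ⟩
      ∑ (λ i → (if does (i ≟ k) then f k else 0ℚ) + erase k f i)   ≡⟨ ∑-+ _ _ ⟩
      ∑ (λ i → if does (i ≟ k) then f k else 0ℚ) + ∑ (erase k f)   ≡⟨ cong (_+ ∑ (erase k f)) (∑-δ k (f k)) ⟩
      f k + ∑ (erase k f)                                          ∎
      where
      open ≡-Reasoning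
      split : ∀ i → f i ≡ (if does (i ≟ k) then f k else 0ℚ) + erase k f i
      split i with i ≟ k
      ... | yes refl = sym (ℚₚ.+-identityʳ (f i))
      ... | no  _    = sym (ℚₚ.+-identityˡ (f i))

    ∑-≥-distinct : ∀ {f} → (∀ i → 0ℚ ≤ f i) → ∀ {ks} → AllPairs _≢_ ks → ∑ₗ f ks ≤ ∑ f
    ∑-≥-distinct f≥0 []                     = ∑-nonNeg f≥0
    ∑-≥-distinct {f} f≥0 {k ∷ ks} (k∉ks ∷ ks!) = begin
      f k + ∑ₗ f ks             ≡⟨ cong (f k +_) (∑ₗ-congᴬ (All-erase-other k∉ks)) ⟩
      f k + ∑ₗ (erase k f) ks   ≤⟨ ℚₚ.+-monoʳ-≤ (f k) (∑-≥-distinct (erase-nonNeg k f≥0) ks!) ⟩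
      f k + ∑ (erase k f)       ≡⟨ ∑-split f k ⟨
      ∑ f                       ∎
      where
      open ℚₚ.≤-Reasoning
      All-erase-other : ∀ {js} → All (k ≢_) js → All (λ j → f j ≡ erase k f j) js
      All-erase-other []            = []
      All-erase-other (k≢j ∷ k≢js) = sym (erase-other f (k≢j ∘ sym)) ∷ All-erase-other k≢js

    ∑-≥-term : ∀ {f} → (∀ i → 0ℚ ≤ f i) → ∀ k → f k ≤ ∑ f
    ∑-≥-term {f} f≥0 k = subst (_≤ ∑ f) (ℚₚ.+-identityʳ (f k)) (∑-≥-distinct f≥0 ([] ∷ []))

    ∑-≤-support : ∀ {f} → (∀ i → 0ℚ ≤ f i) → ∀ ks → (∀ i → i ∈ ks ⊎ f i ≡ 0ℚ) → ∑ f ≤ ∑ₗ f ks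
    ∑-≤-support {f} f≥0 [] supp = ℚₚ.≤-reflexive (trans (∑-cong vanish) ∑-zero)
      where
      vanish : ∀ i → f i ≡ 0ℚ
      vanish i with supp i
      ... | inj₂ fᵢ≡0 = fᵢ≡0
    ∑-≤-support {f} f≥0 (k ∷ ks) supp = begin
      ∑ f                       ≡⟨ ∑-split f k ⟩
      f k + ∑ (erase k f)       ≤⟨ ℚₚ.+-monoʳ-≤ (f k) (∑-≤-support (erase-nonNeg k f≥0) ks supp′) ⟩
      f k + ∑ₗ (erase k f) ks   ≤⟨ ℚₚ.+-monoʳ-≤ (f k) (∑ₗ-mono-≤ (erase-≤ k f≥0) ks) ⟩
      f k + ∑ₗ f ks             ∎
      where
      open ℚₚ.≤-Reasoning
      supp′ : ∀ i → i ∈ ks ⊎ erase k f i ≡ 0ℚ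
      supp′ i with i ≟ k
      ... | yes _ = inj₂ refl
      ... | no  i≢k with supp i
      ...   | inj₁ (here i≡k)  = ⊥-elim (i≢k i≡k)
      ...   | inj₁ (there i∈ks) = inj₁ i∈ks
      ...   | inj₂ fᵢ≡0         = inj₂ fᵢ≡0

    ∑-≡⇒≡ : ∀ {f g} → (∀ i → f i ≤ g i) → ∑ f ≡ ∑ g → ∀ i → f i ≡ g i
    ∑-≡⇒≡ {f} {g} f≤g ∑f≡∑g k = ℚₚ.≤-antisym (f≤g k) (+-cancelʳ-≤ (begin
      g k + ∑ (erase k g)       ≡⟨ ∑-split g k ⟨
      ∑ g                       ≡⟨ ∑f≡∑g ⟨
      ∑ f                       ≡⟨ ∑-split f k ⟩
      f k + ∑ (erase k f)       ≤⟨ ℚₚ.+-monoʳ-≤ (f k) (∑-mono-≤ (erase-mono-≤ k f≤g)) ⟩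
      f k + ∑ (erase k g)       ∎))
      where open ℚₚ.≤-Reasoning

  module ∑₁ {n : ℕ} = SummationProperties (finSummation n)
  module ∑₂ {n : ℕ} = SummationProperties (pairSummation n)

  false≢true : false ≢ true
  false≢true ()

  ltᵇ : ∀ {n} → Fin n → Fin n → Bool
  ltᵇ a b = toℕ a ℕ.<ᵇ toℕ b

  ltᵇ-asym : ∀ {n} (a b : Fin n) → ltᵇ a b ≡ true → ltᵇ b a ≡ false
  ltᵇ-asym a b a<b with ltᵇ b a in b<a
  ... | false = refl
  ... | true  = ⊥-elim (ℕₚ.<-asym (ℕₚ.<ᵇ⇒< (toℕ a) (toℕ b) (subst T (sym a<b) _)) (ℕₚ.<ᵇ⇒< (toℕ b) (toℕ a) (subst T (sym b<a) _)))

  ltᵇ-tri : ∀ {n} (a b : Fin n) → ltᵇ a b ≡ false → ltᵇ b a ≡ false → a ≡ b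
  ltᵇ-tri a b a≮b b≮a with ℕₚ.<-cmp (toℕ a) (toℕ b)
  ... | tri< a<b _ _ = ⊥-elim (subst T a≮b (ℕₚ.<⇒<ᵇ a<b))
  ... | tri≈ _ a≡b _ = Finₚ.toℕ-injective a≡b
  ... | tri> _ _ b<a = ⊥-elim (subst T b≮a (ℕₚ.<⇒<ᵇ b<a))

  ∑∑-symmetric : ∀ {n} (h : Fin n → Fin n → ℚ) → (∀ a b → h a b ≡ h b a) → (∀ a → h a a ≡ 0ℚ) →
                 ∑∑ h ≡ 2ℚ * ∑∑ (λ a b → if ltᵇ a b then h a b else 0ℚ)
  ∑∑-symmetric {n} h h-sym h-diag = begin
    ∑∑ h                                       ≡⟨ ∑∑-cong split ⟩
    ∑∑ (λ a b → upper a b + upper b a)          ≡⟨ ∑∑-+ upper (λ a b → upper b a) ⟩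
    ∑∑ upper + ∑∑ (λ a b → upper b a)           ≡⟨ cong (∑∑ upper +_) (∑-comm (λ a b → upper b a)) ⟩
    ∑∑ upper + ∑∑ upper                         ≡⟨ 2*p≡p+p (∑∑ upper) ⟨
    2ℚ * ∑∑ upper                               ∎
    where
    open ≡-Reasoning
    upper : Fin n → Fin n → ℚ
    upper a b = if ltᵇ a b then h a b else 0ℚ
    split : ∀ a b → h a b ≡ upper a b + upper b a
    split a b with ltᵇ a b in a<b | ltᵇ b a in b<a
    ... | true  | true  = ⊥-elim (false≢true (trans (sym (ltᵇ-asym a b a<b)) b<a))
    ... | true  | false = sym (ℚₚ.+-identityʳ _)
    ... | false | true  = trans (h-sym a b) (sym (ℚₚ.+-identityˡ _))
    ... | false | false = trans (subst (λ b → h a b ≡ 0ℚ) (ltᵇ-tri a b a<b b<a) (h-diag a)) (sym (ℚₚ.+-identityˡ _))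

  if-∑∑ : ∀ {n} (c : Bool) (h : Fin n → Fin n → ℚ) → (if c then ∑∑ h else 0ℚ) ≡ ∑∑ (λ a b → if c then h a b else 0ℚ)
  if-∑∑ c h = trans (if-∑ c (λ a → sum (h a))) (sum-cong-≗ (λ a → if-∑ c (h a)))

  ∑∑-≥-distinct : ∀ {n} {h : Fin n → Fin n → ℚ} → (∀ a b → 0ℚ ≤ h a b) →
                  ∀ {ps} → AllPairs _≢_ ps → ∑ₗ (uncurry h) ps ≤ ∑∑ h
  ∑∑-≥-distinct h≥0 = ∑₂.∑-≥-distinct (uncurry h≥0)

  ∑∑-≤-support : ∀ {n} {h : Fin n → Fin n → ℚ} → (∀ a b → 0ℚ ≤ h a b) →
                 ∀ ps → (∀ a b → (a , b) ∈ ps ⊎ h a b ≡ 0ℚ) → ∑∑ h ≤ ∑ₗ (uncurry h) ps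
  ∑∑-≤-support h≥0 ps supp = ∑₂.∑-≤-support (uncurry h≥0) ps (uncurry supp)

  ∑∑-≡⇒≡ : ∀ {n} {g h : Fin n → Fin n → ℚ} → (∀ a b → g a b ≤ h a b) → ∑∑ g ≡ ∑∑ h → ∀ a b → g a b ≡ h a b
  ∑∑-≡⇒≡ g≤h ∑g≡∑h a b = ∑₂.∑-≡⇒≡ (uncurry g≤h) ∑g≡∑h (a , b)

  count-≡ : ∀ n k (p : Fin n → Bool) (f : Fin k → Fin n) → (∀ {i j} → f i ≡ f j → i ≡ j) →
            (∀ y → p y ≡ true → ∃[ i ] f i ≡ y) → (∀ i → p (f i) ≡ true) → count n p ≡ k
  count-≡ n k p f f-inj f-onto f-into = ℕ→ℚ-injective (begin
    ℕ→ℚ (count n p)                                ≡⟨ ℕ→ℚ-count n p ⟩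
    ∑[ y < n ] 𝟙 (p y)                             ≡⟨ sum-cong-≗ fibre ⟩
    ∑[ y < n ] ∑[ i < k ] 𝟙 (does (y Fin.≟ f i))   ≡⟨ ∑-comm (λ y i → 𝟙 (does (y Fin.≟ f i))) ⟩
    ∑[ i < k ] ∑[ y < n ] 𝟙 (does (y Fin.≟ f i))   ≡⟨ sum-cong-≗ (λ i → sum-δ (f i) 1ℚ) ⟩
    ∑[ i < k ] 1ℚ                                  ≡⟨ sum-const k 1ℚ ⟩
    ℕ→ℚ k * 1ℚ                                     ≡⟨ ℚₚ.*-identityʳ (ℕ→ℚ k) ⟩
    ℕ→ℚ k                                          ∎)
    where
    open ≡-Reasoning
    fibre : ∀ y → 𝟙 (p y) ≡ ∑[ i < k ] 𝟙 (does (y Fin.≟ f i))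
    fibre y with p y in py
    ... | true  = sym (trans (sum-cong-≗ (λ i → cong 𝟙 (preimage i))) (sum-δ i₀ 1ℚ))
      where
      i₀ = proj₁ (f-onto y py)
      fi₀≡y = proj₂ (f-onto y py)
      preimage : ∀ i → does (y Fin.≟ f i) ≡ does (i Fin.≟ i₀)
      preimage i with i Fin.≟ i₀
      ... | yes refl = dec-true (y Fin.≟ f i) (sym fi₀≡y)
      ... | no  i≢i₀ = dec-false (y Fin.≟ f i) (λ y≡fi → i≢i₀ (f-inj (trans (sym y≡fi) (sym fi₀≡y))))
    ... | false = sym (trans (sum-cong-≗ (λ i → cong 𝟙 (dec-false (y Fin.≟ f i) (not-image i)))) (sum-replicate-zero k))
      where
      not-image : ∀ i → y ≢ f i
      not-image i refl = false≢true (trans (sym py) (f-into i))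

  lookup-injective : ∀ {A : Set} (xs : List A) → Unique xs → ∀ {i j} → lookup xs i ≡ lookup xs j → i ≡ j
  lookup-injective (x ∷ xs) (x∉ ∷ xs!) {zero}  {zero}  _ = refl
  lookup-injective (x ∷ xs) (x∉ ∷ xs!) {zero}  {suc j} e = ⊥-elim (All.lookup x∉ (∈-lookup j) e)
  lookup-injective (x ∷ xs) (x∉ ∷ xs!) {suc i} {zero}  e = ⊥-elim (All.lookup x∉ (∈-lookup i) (sym e))
  lookup-injective (x ∷ xs) (x∉ ∷ xs!) {suc i} {suc j} e = cong suc (lookup-injective xs xs! e)

  enumerate : ∀ {n k} (p : Fin n → Bool) → count n p ≡ k →
              Σ (Fin k → Fin n) λ f → (∀ i → p (f i) ≡ true) × (∀ {i j} → f i ≡ f j → i ≡ j) × (∀ y → p y ≡ true → ∃[ i ] f i ≡ y)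
  enumerate {n} p refl = lookup xs , into , lookup-injective xs unique , onto
    where
    xs = filterᵇ p (allFin n)
    unique : Unique xs
    unique = Uniqueₚ.filter⁺ (T? ∘ p) (Uniqueₚ.allFin⁺ n)
    into : ∀ i → p (lookup xs i) ≡ true
    into i = Equivalence.to Boolₚ.T-≡ (proj₂ (∈-filter⁻ (T? ∘ p) {xs = allFin n} (∈-lookup i)))
    onto : ∀ y → p y ≡ true → ∃[ i ] lookup xs i ≡ y
    onto y py = let y∈xs = ∈-filter⁺ (T? ∘ p) (∈-allFin y) (Equivalence.from Boolₚ.T-≡ py)
                in Any.index y∈xs , sym (Anyₚ.lookup-index y∈xs)


open FiniteSums

module EdgeSums (G : Graph) where
  open import Data.Rational using (_≤_)
  open import Data.List using (allFin; cartesianProduct)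
  open import Data.List.Membership.Propositional using (_∈_)
  open import Data.List.Membership.Propositional.Properties using (∈-filter⁺; ∈-filter⁻; ∈-cartesianProduct⁺; ∈-allFin)
  open import Data.Bool.Properties using (T?)
  open import Function using (Equivalence)
  open import Algebra.Solver.CommutativeMonoid Boolₚ.∨-commutativeMonoid using (solve; _⊕_; _⊜_)

  N : ℕ
  N = n G

  A : Fin N → Fin N → Bool
  A = adj G

  A-sym : ∀ a b → A a b ≡ A b a
  A-sym = Graph.sym G

  A-irrefl : ∀ a → A a a ≡ false
  A-irrefl = Graph.irrefl G

  adj⇒≢ : ∀ {a b} → A a b ≡ true → a ≢ b
  adj⇒≢ {a} a~b refl = false≢true (trans (sym (A-irrefl a)) a~b)

  =ᵛ-refl : ∀ {m} (a : Fin m) → (a =ᵛ a) ≡ true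
  =ᵛ-refl a = Equivalence.to Boolₚ.T-≡ (ℕₚ.≡⇒≡ᵇ (toℕ a) (toℕ a) refl)

  =ᵛ⇒≡ : ∀ {m} {a b : Fin m} → (a =ᵛ b) ≡ true → a ≡ b
  =ᵛ⇒≡ {a = a} {b} a=b = Finₚ.toℕ-injective (ℕₚ.≡ᵇ⇒≡ (toℕ a) (toℕ b) (Equivalence.from Boolₚ.T-≡ a=b))

  arc : (Fin N → Fin N → ℚ) → Fin N → Fin N → ℚ
  arc h a b = if A a b then h a b else 0ℚ

  ∑-arcs : (Fin N → Fin N → ℚ) → ℚ
  ∑-arcs h = ∑∑ (arc h)

  ∈-edges : ∀ {a b} → ltᵇ a b ≡ true → A a b ≡ true → (a , b) ∈ edges G
  ∈-edges {a} {b} a<b a~b = ∈-filter⁺ (λ e → T? (ltᵇ (proj₁ e) (proj₂ e) ∧ A (proj₁ e) (proj₂ e)))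
    (∈-cartesianProduct⁺ (∈-allFin a) (∈-allFin b)) (Equivalence.from Boolₚ.T-≡ (cong₂ _∧_ a<b a~b))

  ∈-edges⁻ : ∀ {a b} → (a , b) ∈ edges G → A a b ≡ true
  ∈-edges⁻ {a} {b} ab∈E = Equivalence.to Boolₚ.T-≡ (proj₂ (Equivalence.to Boolₚ.T-∧
    (proj₂ (∈-filter⁻ (λ e → T? (ltᵇ (proj₁ e) (proj₂ e) ∧ A (proj₁ e) (proj₂ e)))
                      {xs = cartesianProduct (allFin N) (allFin N)} ab∈E))))

  ∑ₗ-edges : ∀ (f : Fin N × Fin N → ℚ) → ∑ₗ f (edges G) ≡ ∑∑ (λ a b → if ltᵇ a b ∧ A a b then f (a , b) else 0ℚ)
  ∑ₗ-edges f = trans (∑ₗ-filterᵇ f _ (cartesianProduct (allFin N) (allFin N)))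
    (trans (∑ₗ-cartesianProduct _ (allFin N) (allFin N))
    (trans (∑ₗ-cong (λ a → ∑ₗ-allFin N _) (allFin N)) (∑ₗ-allFin N _)))

  ∑ₗ-edges-cong : ∀ {f g : Fin N → Fin N → ℚ} → (∀ a b → ltᵇ a b ≡ true → A a b ≡ true → f a b ≡ g a b) →
                  ∑ₗ (uncurry f) (edges G) ≡ ∑ₗ (uncurry g) (edges G)
  ∑ₗ-edges-cong {f} {g} f≗g = trans (∑ₗ-edges (uncurry f)) (trans (∑∑-cong pointwise) (sym (∑ₗ-edges (uncurry g))))
    where
    pointwise : ∀ a b → (if ltᵇ a b ∧ A a b then f a b else 0ℚ) ≡ (if ltᵇ a b ∧ A a b then g a b else 0ℚ)
    pointwise a b with ltᵇ a b in a<b | A a b in a~b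
    ... | true  | true  = f≗g a b a<b a~b
    ... | true  | false = refl
    ... | false | _     = refl

  2*∑ₗ-edges : ∀ (h : Fin N → Fin N → ℚ) → (∀ a b → h a b ≡ h b a) → 2ℚ * ∑ₗ (uncurry h) (edges G) ≡ ∑-arcs h
  2*∑ₗ-edges h h-sym = sym (begin
    ∑∑ (arc h)                                                      ≡⟨ ∑∑-symmetric (arc h) arc-sym arc-diag ⟩
    2ℚ * ∑∑ (λ a b → if ltᵇ a b then arc h a b else 0ℚ)             ≡⟨ cong (2ℚ *_) (∑∑-cong guards) ⟩
    2ℚ * ∑∑ (λ a b → if ltᵇ a b ∧ A a b then h a b else 0ℚ)         ≡⟨ cong (2ℚ *_) (∑ₗ-edges (uncurry h)) ⟨
    2ℚ * ∑ₗ (uncurry h) (edges G)                                   ∎)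
    where
    open ≡-Reasoning
    arc-sym : ∀ a b → arc h a b ≡ arc h b a
    arc-sym a b rewrite A-sym a b | h-sym a b = refl
    arc-diag : ∀ a → arc h a a ≡ 0ℚ
    arc-diag a rewrite A-irrefl a = refl
    guards : ∀ a b → (if ltᵇ a b then arc h a b else 0ℚ) ≡ (if ltᵇ a b ∧ A a b then h a b else 0ℚ)
    guards a b with ltᵇ a b
    ... | true  = refl
    ... | false = refl

  touches : Fin N → Fin N → Fin N → Fin N → Bool
  touches u v a b = incidentᵇ (u , v) (a , b)

  touches-intro : ∀ {u v a b} → u ≡ a ⊎ u ≡ b ⊎ v ≡ a ⊎ v ≡ b → touches u v a b ≡ true
  touches-intro {u} {v} {a} {b} (inj₁ refl) rewrite =ᵛ-refl u = refl
  touches-intro {u} {v} {a} {b} (inj₂ (inj₁ refl)) rewrite =ᵛ-refl u = Boolₚ.∨-zeroʳ (u =ᵛ a)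
  touches-intro {u} {v} {a} {b} (inj₂ (inj₂ (inj₁ refl)))
    rewrite =ᵛ-refl v | Boolₚ.∨-zeroʳ (u =ᵛ b) = Boolₚ.∨-zeroʳ (u =ᵛ a)
  touches-intro {u} {v} {a} {b} (inj₂ (inj₂ (inj₂ refl)))
    rewrite =ᵛ-refl v | Boolₚ.∨-zeroʳ (v =ᵛ a) | Boolₚ.∨-zeroʳ (u =ᵛ b) = Boolₚ.∨-zeroʳ (u =ᵛ a)

  touches-elim : ∀ {u v a b} → touches u v a b ≡ true → u ≡ a ⊎ u ≡ b ⊎ v ≡ a ⊎ v ≡ b
  touches-elim {u} {v} {a} {b} t with u =ᵛ a in u=a | u =ᵛ b in u=b | v =ᵛ a in v=a | v =ᵛ b in v=b
  ... | true  | _     | _     | _     = inj₁ (=ᵛ⇒≡ u=a)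
  ... | false | true  | _     | _     = inj₂ (inj₁ (=ᵛ⇒≡ u=b))
  ... | false | false | true  | _     = inj₂ (inj₂ (inj₁ (=ᵛ⇒≡ v=a)))
  ... | false | false | false | true  = inj₂ (inj₂ (inj₂ (=ᵛ⇒≡ v=b)))

  touches-flipʳ : ∀ u v a b → touches u v a b ≡ touches u v b a
  touches-flipʳ u v a b = solve 4 (λ p q r s → p ⊕ (q ⊕ (r ⊕ s)) ⊜ q ⊕ (p ⊕ (s ⊕ r))) refl (u =ᵛ a) (u =ᵛ b) (v =ᵛ a) (v =ᵛ b)

  touches-flipˡ : ∀ u v a b → touches u v a b ≡ touches v u a b
  touches-flipˡ u v a b = solve 4 (λ p q r s → p ⊕ (q ⊕ (r ⊕ s)) ⊜ r ⊕ (s ⊕ (p ⊕ q))) refl (u =ᵛ a) (u =ᵛ b) (v =ᵛ a) (v =ᵛ b)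

  -- A weighting is only read at (a , b) with a < b, the orientation in which edges G lists an edge.
  weight : Weighting G → Fin N → Fin N → ℚ
  weight x a b = if ltᵇ a b then x a b else x b a

  weight-comm : ∀ x a b → weight x a b ≡ weight x b a
  weight-comm x a b with ltᵇ a b in a<b | ltᵇ b a in b<a
  ... | true  | true  = ⊥-elim (false≢true (trans (sym (ltᵇ-asym a b a<b)) b<a))
  ... | true  | false = refl
  ... | false | true  = refl
  ... | false | false rewrite ltᵇ-tri a b a<b b<a = refl

  weight-ordered : ∀ x {a b} → ltᵇ a b ≡ true → weight x a b ≡ x a b
  weight-ordered x a<b rewrite a<b = refl

  δ-weight : Weighting G → Fin N → Fin N → Fin N → Fin N → ℚ
  δ-weight x u v a b = if touches u v a b then weight x a b else 0ℚ

  2*total : ∀ x → 2ℚ * total G x ≡ ∑-arcs (weight x)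
  2*total x = trans (cong (2ℚ *_) (∑ₗ-edges-cong (λ a b a<b _ → sym (weight-ordered x a<b))))
                    (2*∑ₗ-edges (weight x) (weight-comm x))

  2*δsum : ∀ x u v → 2ℚ * δsum G x (u , v) ≡ ∑-arcs (δ-weight x u v)
  2*δsum x u v = begin
    2ℚ * δsum G x (u , v)                                                            ≡⟨ cong (2ℚ *_) (∑ₗ-filterᵇ (uncurry x) _ (edges G)) ⟩
    2ℚ * ∑ₗ (uncurry (λ a b → if touches u v a b then x a b else 0ℚ)) (edges G)    ≡⟨ cong (2ℚ *_) (∑ₗ-edges-cong ordered) ⟩
    2ℚ * ∑ₗ (uncurry (δ-weight x u v)) (edges G)                                    ≡⟨ 2*∑ₗ-edges (δ-weight x u v) δ-weight-comm ⟩
    ∑-arcs (δ-weight x u v)                                                          ∎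
    where
    open ≡-Reasoning
    ordered : ∀ a b → ltᵇ a b ≡ true → A a b ≡ true → (if touches u v a b then x a b else 0ℚ) ≡ δ-weight x u v a b
    ordered a b a<b _ = cong (if touches u v a b then_else 0ℚ) (sym (weight-ordered x a<b))
    δ-weight-comm : ∀ a b → δ-weight x u v a b ≡ δ-weight x u v b a
    δ-weight-comm a b rewrite touches-flipʳ u v a b | weight-comm x a b = refl

  arc-at : ∀ h {a b} → A a b ≡ true → arc h a b ≡ h a b
  arc-at h {a} {b} a~b = cong (if_then h a b else 0ℚ) a~b

  arc-δ-at : ∀ x u v {a b} → A a b ≡ true → touches u v a b ≡ true → arc (δ-weight x u v) a b ≡ weight x a b
  arc-δ-at x u v {a} {b} a~b t = trans (arc-at (δ-weight x u v) a~b) (cong (if_then weight x a b else 0ℚ) t)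

  arc-δ-nonNeg : ∀ x → (∀ {a b} → A a b ≡ true → 0ℚ ≤ weight x a b) → ∀ u v a b → 0ℚ ≤ arc (δ-weight x u v) a b
  arc-δ-nonNeg x weight≥0 u v a b with A a b in a~b | touches u v a b
  ... | true  | true  = weight≥0 a~b
  ... | true  | false = ℚₚ.≤-refl
  ... | false | _     = ℚₚ.≤-refl


module Connectivity (G : Graph) where
  open EdgeSums G using (N; A)

  reach-trans : ∀ {u v w} → Reach G u v → Reach G v w → Reach G u w
  reach-trans here          r₂ = r₂
  reach-trans (step e r₁) r₂ = step e (reach-trans r₁ r₂)

  first-step : ∀ {u t} → Reach G u t → u ≢ t → ∃[ y ] A u y ≡ true
  first-step here               u≢u = ⊥-elim (u≢u refl)
  first-step (step {v = y} e _) _   = y , e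

  leave-pair : ∀ {s t} a b → Reach G s t → s ≡ a ⊎ s ≡ b → t ≢ a → t ≢ b →
               ∃[ o ] ∃[ y ] (y ≡ a ⊎ y ≡ b) × A y o ≡ true × o ≢ a × o ≢ b
  leave-pair a b here (inj₁ refl) t≢a _ = ⊥-elim (t≢a refl)
  leave-pair a b here (inj₂ refl) _ t≢b = ⊥-elim (t≢b refl)
  leave-pair {s} a b (step {v = v} e r) s∈ab t≢a t≢b with v Finₚ.≟ a | v Finₚ.≟ b
  ... | yes v≡a | _       = leave-pair a b r (inj₁ v≡a) t≢a t≢b
  ... | no _    | yes v≡b = leave-pair a b r (inj₂ v≡b) t≢a t≢b
  ... | no v≢a  | no v≢b  = v , s , s∈ab , e , v≢a , v≢b

  third-vertex : ∀ a b → ComponentOrderAtLeast3 G a → ∃[ t ] Reach G a t × t ≢ a × t ≢ b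
  third-vertex a b (p₁ , p₂ , p₃ , p₁≢p₂ , p₁≢p₃ , p₂≢p₃ , r₁ , r₂ , r₃)
    with p₁ Finₚ.≟ a | p₁ Finₚ.≟ b | p₂ Finₚ.≟ a | p₂ Finₚ.≟ b | p₃ Finₚ.≟ a | p₃ Finₚ.≟ b
  ... | no p₁≢a | no p₁≢b | _ | _ | _ | _ = p₁ , r₁ , p₁≢a , p₁≢b
  ... | _ | _ | no p₂≢a | no p₂≢b | _ | _ = p₂ , r₂ , p₂≢a , p₂≢b
  ... | _ | _ | _ | _ | no p₃≢a | no p₃≢b = p₃ , r₃ , p₃≢a , p₃≢b
  ... | yes refl | _ | yes refl | _ | _ | _ = ⊥-elim (p₁≢p₂ refl)
  ... | _ | yes refl | _ | yes refl | _ | _ = ⊥-elim (p₁≢p₂ refl)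
  ... | yes refl | _ | _ | _ | yes refl | _ = ⊥-elim (p₁≢p₃ refl)
  ... | _ | yes refl | _ | _ | _ | yes refl = ⊥-elim (p₁≢p₃ refl)
  ... | _ | _ | yes refl | _ | yes refl | _ = ⊥-elim (p₂≢p₃ refl)
  ... | _ | _ | _ | yes refl | _ | yes refl = ⊥-elim (p₂≢p₃ refl)

  module _ (no-small : NoSmallComponent G) where

    outer-neighbour : ∀ a b → ∃[ o ] ∃[ y ] (y ≡ a ⊎ y ≡ b) × A y o ≡ true × o ≢ a × o ≢ b
    outer-neighbour a b =
      let (t , r , t≢a , t≢b) = third-vertex a b (no-small a) in leave-pair a b r (inj₁ refl) t≢a t≢b

    neighbour : ∀ u → ∃[ y ] A u y ≡ true
    neighbour u = let (t , r , t≢u , _) = third-vertex u u (no-small u) in first-step r (t≢u ∘ sym)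


module Spiders (G : Graph) where
  open EdgeSums G using (N; A; A-sym; adj⇒≢)

  record PendantPath (ℓ m c : Fin N) : Set where
    field
      ℓ~m    : A ℓ m ≡ true
      leaf   : ∀ y → A ℓ y ≡ true → y ≡ m
      m~c    : A m c ≡ true
      c≢ℓ    : c ≢ ℓ
      middle : ∀ y → A m y ≡ true → y ≡ ℓ ⊎ y ≡ c

    m~ℓ : A m ℓ ≡ true
    m~ℓ = trans (A-sym m ℓ) ℓ~m

    c~m : A c m ≡ true
    c~m = trans (A-sym c m) m~c

    ℓ≢m : ℓ ≢ m
    ℓ≢m = adj⇒≢ ℓ~m

    m≢c : m ≢ c
    m≢c = adj⇒≢ m~c

    deg-ℓ : deg G ℓ ≡ 1
    deg-ℓ = count-≡ N 1 (A ℓ) (λ _ → m) (λ { {zero} {zero} _ → refl }) (λ y ℓ~y → zero , sym (leaf y ℓ~y)) (λ _ → ℓ~m)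

    deg-m : deg G m ≡ 2
    deg-m = count-≡ N 2 (A m) ends ends-inj ends-onto ends-adj
      where
      ends : Fin 2 → Fin N
      ends zero       = ℓ
      ends (suc zero) = c
      ends-inj : ∀ {i j} → ends i ≡ ends j → i ≡ j
      ends-inj {zero}     {zero}     _   = refl
      ends-inj {zero}     {suc zero} ℓ≡c = ⊥-elim (c≢ℓ (sym ℓ≡c))
      ends-inj {suc zero} {zero}     c≡ℓ = ⊥-elim (c≢ℓ c≡ℓ)
      ends-inj {suc zero} {suc zero} _   = refl
      ends-onto : ∀ y → A m y ≡ true → ∃[ i ] ends i ≡ y
      ends-onto y m~y with middle y m~y
      ... | inj₁ y≡ℓ = zero , sym y≡ℓ
      ... | inj₂ y≡c = suc zero , sym y≡c
      ends-adj : ∀ i → A m (ends i) ≡ true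
      ends-adj zero       = m~ℓ
      ends-adj (suc zero) = m~c

  record Centre (Δ : ℕ) (c : Fin N) : Set where
    field
      degree : deg G c ≡ Δ
      legs   : ∀ z → A c z ≡ true → ∃[ ℓ ] PendantPath ℓ z c

  InSpider : Fin N → Fin N → Set
  InSpider c v = v ≡ c ⊎ A c v ≡ true ⊎ ∃[ z ] A c z ≡ true × A z v ≡ true × v ≢ c

  SpiderCover : ℕ → Set
  SpiderCover Δ = ∀ v → ∃[ c ] Centre Δ c × InSpider c v


module Loads (G : Graph) (Δ : ℕ) (max-deg : MaxDegAtMost G Δ) (no-small : NoSmallComponent G) where
  open import Data.Rational using (_≤_; _<_)
  open import Data.Sum using (map₂)
  open import Data.List.Relation.Unary.All using ([]; _∷_)
  open import Data.List.Relation.Unary.AllPairs using (AllPairs; []; _∷_)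
  open EdgeSums G
  open Connectivity G using (neighbour; outer-neighbour)
  open Spiders G using (PendantPath)

  w : Fin N → ℚ
  w u = Δ ÷ deg G u

  2Δ+1 : ℚ
  2Δ+1 = ℕ→ℚ (suc (Δ ℕ.+ Δ))

  2Δ+1≡Δ+Δ+1 : 2Δ+1 ≡ ℕ→ℚ Δ + ℕ→ℚ Δ + 1ℚ
  2Δ+1≡Δ+Δ+1 = trans (ℕ→ℚ-suc (Δ ℕ.+ Δ)) (trans (cong (1ℚ +_) (ℕ→ℚ-+ Δ Δ)) (ℚₚ.+-comm 1ℚ (ℕ→ℚ Δ + ℕ→ℚ Δ)))

  ∑-neighbours-const : ∀ u k → ∑[ v < N ] (if A u v then k else 0ℚ) ≡ k * ℕ→ℚ (deg G u)
  ∑-neighbours-const u k = begin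
    ∑[ v < N ] (if A u v then k else 0ℚ)   ≡⟨ sum-cong-≗ (λ v → if-as-𝟙 (A u v)) ⟩
    ∑[ v < N ] (k * 𝟙 (A u v))             ≡⟨ *-distribˡ-sum k (λ v → 𝟙 (A u v)) ⟨
    k * ∑[ v < N ] 𝟙 (A u v)               ≡⟨ cong (k *_) (ℕ→ℚ-count N (A u)) ⟨
    k * ℕ→ℚ (deg G u)                      ∎
    where
    open ≡-Reasoning
    if-as-𝟙 : ∀ b → (if b then k else 0ℚ) ≡ k * 𝟙 b
    if-as-𝟙 true  = sym (ℚₚ.*-identityʳ k)
    if-as-𝟙 false = sym (ℚₚ.*-zeroʳ k)

  deg≥1 : ∀ {u y} → A u y ≡ true → 1 ℕ.≤ deg G u
  deg≥1 {u} {y} u~y = ℕ→ℚ-cancel-≤ (subst₂ _≤_ (trans (cong 𝟙 u~y) (sym ℕ→ℚ-one)) (sym (ℕ→ℚ-count N (A u)))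
    (∑₁.∑-≥-term (λ v → 𝟙-nonNeg (A u v)) y))

  deg≡suc : ∀ u → ∃[ d ] deg G u ≡ suc d
  deg≡suc u with deg G u | deg≥1 (proj₂ (neighbour no-small u))
  ... | suc d | _ = d , refl

  w*deg≡Δ : ∀ u → w u * ℕ→ℚ (deg G u) ≡ ℕ→ℚ Δ
  w*deg≡Δ u with deg G u | deg≡suc u
  ... | .(suc d) | d , refl = ÷-*-cancel Δ d

  1≤w : ∀ u → 1ℚ ≤ w u
  1≤w u with deg G u | deg≡suc u | max-deg u
  ... | .(suc d) | d , refl | d<Δ = 1≤÷ d<Δ

  w-nonNeg : ∀ u → 0ℚ ≤ w u
  w-nonNeg u = ℚₚ.≤-trans 0≤1 (1≤w u)

  w≤1⇒deg≡Δ : ∀ u → w u ≤ 1ℚ → deg G u ≡ Δ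
  w≤1⇒deg≡Δ u w≤1 with deg G u | deg≡suc u | max-deg u
  ... | .(suc d) | d , refl | d<Δ = ℕₚ.≤-antisym d<Δ (÷≤1⇒≤ w≤1)

  deg≡Δ⇒w≡1 : ∀ u → deg G u ≡ Δ → w u ≡ 1ℚ
  deg≡Δ⇒w≡1 u deg≡Δ with deg G u | deg≡suc u
  ... | .(suc d) | d , refl = trans (cong (_÷ suc d) (sym deg≡Δ)) (n÷n≡1 d)

  load-term : Fin N → Fin N → Fin N → Fin N → ℚ
  load-term a b u v = w u * 𝟙 (touches u v a b)

  -- The coefficient of x_ab in Σ_(u,v) w(u)·(2 δsum at uv) after exchanging the order of summation.
  load : Fin N → Fin N → ℚ
  load a b = ∑-arcs (load-term a b)

  row : Fin N → Fin N → Fin N → ℚ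
  row u a b = ∑[ v < N ] arc (load-term a b) u v

  arc-load-term-nonNeg : ∀ a b u v → 0ℚ ≤ arc (load-term a b) u v
  arc-load-term-nonNeg a b u v with A u v
  ... | true  = *-nonNeg (w-nonNeg u) (𝟙-nonNeg _)
  ... | false = ℚₚ.≤-refl

  row-nonNeg : ∀ u a b → 0ℚ ≤ row u a b
  row-nonNeg u a b = ∑₁.∑-nonNeg (arc-load-term-nonNeg a b u)

  load-comm : ∀ a b → load a b ≡ load b a
  load-comm a b = ∑∑-cong (λ u v → cong (λ t → if A u v then w u * 𝟙 t else 0ℚ) (touches-flipʳ u v a b))

  row-endpoint : ∀ {u a b} → u ≡ a ⊎ u ≡ b → row u a b ≡ ℕ→ℚ Δ
  row-endpoint {u} {a} {b} u∈ab = begin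
    row u a b                                  ≡⟨ sum-cong-≗ (λ v → cong (λ t → if A u v then w u * 𝟙 t else 0ℚ) (touches-intro (endpoint v))) ⟩
    ∑[ v < N ] (if A u v then w u * 1ℚ else 0ℚ) ≡⟨ ∑-neighbours-const u (w u * 1ℚ) ⟩
    w u * 1ℚ * ℕ→ℚ (deg G u)                   ≡⟨ cong (_* ℕ→ℚ (deg G u)) (ℚₚ.*-identityʳ (w u)) ⟩
    w u * ℕ→ℚ (deg G u)                        ≡⟨ w*deg≡Δ u ⟩
    ℕ→ℚ Δ                                      ∎
    where
    open ≡-Reasoning
    endpoint : ∀ v → u ≡ a ⊎ u ≡ b ⊎ v ≡ a ⊎ v ≡ b
    endpoint _ = map₂ inj₁ u∈ab

  arc-load-term-at : ∀ {a b u v} → A u v ≡ true → touches u v a b ≡ true → arc (load-term a b) u v ≡ w u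
  arc-load-term-at {a} {b} {u} {v} u~v t rewrite u~v | t = ℚₚ.*-identityʳ (w u)

  row-≥ : ∀ {u v a b} → A u v ≡ true → touches u v a b ≡ true → w u ≤ row u a b
  row-≥ {u} {v} {a} {b} u~v t = subst (_≤ row u a b) (arc-load-term-at u~v t)
    (∑₁.∑-≥-term (arc-load-term-nonNeg a b u) v)

  row-≥-both : ∀ {o a b} → A o a ≡ true → A o b ≡ true → a ≢ b → w o + w o ≤ row o a b
  row-≥-both {o} {a} {b} o~a o~b a≢b =
    subst (_≤ row o a b) (cong₂ _+_ (arc-load-term-at o~a (touches-intro {o} {a} {a} {b} (inj₂ (inj₂ (inj₁ refl)))))
                                    (trans (ℚₚ.+-identityʳ _) (arc-load-term-at o~b (touches-intro {o} {b} {a} {b} (inj₂ (inj₂ (inj₂ refl)))))))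
    (∑₁.∑-≥-distinct (arc-load-term-nonNeg a b o) ((a≢b ∷ []) ∷ [] ∷ []))

  load-≥ : ∀ {a b os} → AllPairs _≢_ (a ∷ b ∷ os) → ℕ→ℚ Δ + ℕ→ℚ Δ + ∑ₗ (λ o → row o a b) os ≤ load a b
  load-≥ {a} {b} {os} distinct = subst (_≤ load a b) endpoints (∑₁.∑-≥-distinct (λ u → row-nonNeg u a b) distinct)
    where
    endpoints : row a a b + (row b a b + ∑ₗ (λ o → row o a b) os) ≡ ℕ→ℚ Δ + ℕ→ℚ Δ + ∑ₗ (λ o → row o a b) os
    endpoints = trans (cong₂ (λ s t → s + (t + ∑ₗ (λ o → row o a b) os)) (row-endpoint (inj₁ refl)) (row-endpoint (inj₂ refl)))
                      (sym (ℚₚ.+-assoc (ℕ→ℚ Δ) (ℕ→ℚ Δ) _))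

  2Δ+1≤load : ∀ {a b} → A a b ≡ true → 2Δ+1 ≤ load a b
  2Δ+1≤load {a} {b} a~b with outer-neighbour no-small a b
  ... | o , y , y∈ab , y~o , o≢a , o≢b = begin
    2Δ+1                                        ≡⟨ 2Δ+1≡Δ+Δ+1 ⟩
    ℕ→ℚ Δ + ℕ→ℚ Δ + 1ℚ                          ≤⟨ ℚₚ.+-monoʳ-≤ (ℕ→ℚ Δ + ℕ→ℚ Δ) (ℚₚ.≤-trans (1≤w o) o-row) ⟩
    ℕ→ℚ Δ + ℕ→ℚ Δ + row o a b                   ≡⟨ cong (ℕ→ℚ Δ + ℕ→ℚ Δ +_) (ℚₚ.+-identityʳ (row o a b)) ⟨
    ℕ→ℚ Δ + ℕ→ℚ Δ + ∑ₗ (λ o → row o a b) (o ∷ []) ≤⟨ load-≥ abo-distinct ⟩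
    load a b                                    ∎
    where
    open ℚₚ.≤-Reasoning
    o~y : A o y ≡ true
    o~y = trans (A-sym o y) y~o
    o-row : w o ≤ row o a b
    o-row = row-≥ o~y (touches-intro {o} {y} {a} {b} (inj₂ (inj₂ y∈ab)))
    abo-distinct : AllPairs _≢_ (a ∷ b ∷ o ∷ [])
    abo-distinct = (adj⇒≢ a~b ∷ (o≢a ∘ sym) ∷ []) ∷ ((o≢b ∘ sym) ∷ []) ∷ [] ∷ []


  -- The endpoints of ab already account for 2Δ of its load, so the rows of all other vertices sum to at most 1.
  module _ {a b} (a~b : A a b ≡ true) (load≤ : load a b ≤ 2Δ+1) where

    outer-rows≤1 : ∀ {os} → AllPairs _≢_ (a ∷ b ∷ os) → ∑ₗ (λ o → row o a b) os ≤ 1ℚ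
    outer-rows≤1 distinct = +-cancelˡ-≤ {r = ℕ→ℚ Δ + ℕ→ℚ Δ} (ℚₚ.≤-trans (load-≥ distinct) (subst (load a b ≤_) 2Δ+1≡Δ+Δ+1 load≤))

    w≤row : ∀ {u} → A u a ≡ true ⊎ A u b ≡ true → w u ≤ row u a b
    w≤row {u} (inj₁ u~a) = row-≥ u~a (touches-intro {u} {a} {a} {b} (inj₂ (inj₂ (inj₁ refl))))
    w≤row {u} (inj₂ u~b) = row-≥ u~b (touches-intro {u} {b} {a} {b} (inj₂ (inj₂ (inj₂ refl))))

    outer-deg : ∀ {o} → o ≢ a → o ≢ b → A o a ≡ true ⊎ A o b ≡ true → deg G o ≡ Δ
    outer-deg {o} o≢a o≢b o-near = w≤1⇒deg≡Δ o (ℚₚ.≤-trans (w≤row o-near)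
      (subst (_≤ 1ℚ) (ℚₚ.+-identityʳ (row o a b)) (outer-rows≤1 ((adj⇒≢ a~b ∷ (o≢a ∘ sym) ∷ []) ∷ ((o≢b ∘ sym) ∷ []) ∷ [] ∷ []))))

    no-common-neighbour : ∀ {o} → o ≢ a → o ≢ b → A o a ≡ true → A o b ≡ true → ⊥
    no-common-neighbour {o} o≢a o≢b o~a o~b = 2≰1 (begin
      2ℚ                 ≤⟨ ℚₚ.+-mono-≤ (1≤w o) (1≤w o) ⟩
      w o + w o          ≤⟨ row-≥-both o~a o~b (adj⇒≢ a~b) ⟩
      row o a b          ≡⟨ ℚₚ.+-identityʳ (row o a b) ⟨
      row o a b + 0ℚ     ≤⟨ outer-rows≤1 ((adj⇒≢ a~b ∷ (o≢a ∘ sym) ∷ []) ∷ ((o≢b ∘ sym) ∷ []) ∷ [] ∷ []) ⟩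
      1ℚ                 ∎)
      where open ℚₚ.≤-Reasoning

    no-two-outer : ∀ {z o} → z ≢ a → z ≢ b → o ≢ a → o ≢ b → z ≢ o →
                   A z a ≡ true ⊎ A z b ≡ true → A o a ≡ true ⊎ A o b ≡ true → ⊥
    no-two-outer {z} {o} z≢a z≢b o≢a o≢b z≢o z-near o-near = 2≰1 (begin
      2ℚ                            ≤⟨ ℚₚ.+-mono-≤ (1≤w z) (1≤w o) ⟩
      w z + w o                     ≤⟨ ℚₚ.+-mono-≤ (w≤row z-near) (w≤row o-near) ⟩
      row z a b + row o a b         ≡⟨ cong (row z a b +_) (ℚₚ.+-identityʳ (row o a b)) ⟨
      row z a b + (row o a b + 0ℚ)  ≤⟨ outer-rows≤1 distinct ⟩
      1ℚ                            ∎)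
      where
      open ℚₚ.≤-Reasoning
      distinct : AllPairs _≢_ (a ∷ b ∷ z ∷ o ∷ [])
      distinct = (adj⇒≢ a~b ∷ (z≢a ∘ sym) ∷ (o≢a ∘ sym) ∷ []) ∷ ((z≢b ∘ sym) ∷ (o≢b ∘ sym) ∷ []) ∷ (z≢o ∷ []) ∷ [] ∷ []

    tight-load⇒pendant : ∀ {o} → A b o ≡ true → o ≢ a → o ≢ b → PendantPath a b o × deg G o ≡ Δ
    tight-load⇒pendant {o} b~o o≢a o≢b = path , outer-deg o≢a o≢b (inj₂ o~b)
      where
      o~b : A o b ≡ true
      o~b = trans (A-sym o b) b~o
      leaf : ∀ z → A a z ≡ true → z ≡ b
      leaf z a~z with z Finₚ.≟ b | z Finₚ.≟ o
      ... | yes z≡b | _        = z≡b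
      ... | no _    | yes refl = ⊥-elim (no-common-neighbour o≢a o≢b (trans (A-sym z a) a~z) o~b)
      ... | no z≢b  | no z≢o   = ⊥-elim (no-two-outer (adj⇒≢ a~z ∘ sym) z≢b o≢a o≢b z≢o (inj₁ (trans (A-sym z a) a~z)) (inj₂ o~b))
      middle : ∀ z → A b z ≡ true → z ≡ a ⊎ z ≡ o
      middle z b~z with z Finₚ.≟ a | z Finₚ.≟ o
      ... | yes z≡a | _       = inj₁ z≡a
      ... | no _    | yes z≡o = inj₂ z≡o
      ... | no z≢a  | no z≢o  = ⊥-elim (no-two-outer z≢a (adj⇒≢ b~z ∘ sym) o≢a o≢b z≢o (inj₂ (trans (A-sym z b) b~z)) (inj₂ o~b))
      path : PendantPath a b o
      path = record { ℓ~m = a~b ; leaf = leaf ; m~c = b~o ; c≢ℓ = o≢a ; middle = middle }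


module UpperBound (G : Graph) (Δ : ℕ) (max-deg : MaxDegAtMost G Δ) (no-small : NoSmallComponent G) where
  open import Data.Rational using (_≤_; _<_)
  open import Data.Rational.Solver using (module +-*-Solver)
  open EdgeSums G
  open Loads G Δ max-deg no-small

  exchange : ∀ x → ∑-arcs (λ u v → w u * ∑-arcs (δ-weight x u v)) ≡ ∑-arcs (λ a b → weight x a b * load a b)
  exchange x = begin
    ∑∑ (λ u v → if A u v then w u * ∑-arcs (δ-weight x u v) else 0ℚ)   ≡⟨ ∑∑-cong by-constraint ⟩
    ∑∑ (λ u v → ∑∑ (F u v))                                            ≡⟨ ∑∑-comm F ⟩
    ∑∑ (λ a b → ∑∑ (λ u v → F u v a b))                                ≡⟨ ∑∑-cong by-edge ⟨
    ∑∑ (λ a b → if A a b then weight x a b * load a b else 0ℚ)         ∎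
    where
    open ≡-Reasoning
    F : Fin N → Fin N → Fin N → Fin N → ℚ
    F u v a b = if A u v ∧ A a b ∧ touches u v a b then w u * weight x a b else 0ℚ
    by-constraint : ∀ u v → (if A u v then w u * ∑-arcs (δ-weight x u v) else 0ℚ) ≡ ∑∑ (F u v)
    by-constraint u v = trans (cong (if A u v then_else 0ℚ) (∑∑-*ˡ (w u) (arc (δ-weight x u v))))
      (trans (if-∑∑ (A u v) (λ a b → w u * arc (δ-weight x u v) a b)) (∑∑-cong term))
      where
      term : ∀ a b → (if A u v then w u * arc (δ-weight x u v) a b else 0ℚ) ≡ F u v a b
      term a b with A u v | A a b | touches u v a b
      ... | true  | true  | true  = refl
      ... | true  | true  | false = ℚₚ.*-zeroʳ (w u)
      ... | true  | false | _     = ℚₚ.*-zeroʳ (w u)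
      ... | false | _     | _     = refl
    by-edge : ∀ a b → (if A a b then weight x a b * load a b else 0ℚ) ≡ ∑∑ (λ u v → F u v a b)
    by-edge a b = trans (cong (if A a b then_else 0ℚ) (∑∑-*ˡ (weight x a b) (arc (load-term a b))))
      (trans (if-∑∑ (A a b) (λ u v → weight x a b * arc (load-term a b) u v)) (∑∑-cong term))
      where
      term : ∀ u v → (if A a b then weight x a b * arc (load-term a b) u v else 0ℚ) ≡ F u v a b
      term u v with A u v | A a b | touches u v a b
      ... | true  | true  | true  = trans (cong (weight x a b *_) (ℚₚ.*-identityʳ (w u))) (ℚₚ.*-comm (weight x a b) (w u))
      ... | true  | true  | false = trans (cong (weight x a b *_) (ℚₚ.*-zeroʳ (w u))) (ℚₚ.*-zeroʳ (weight x a b))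
      ... | true  | false | _     = refl
      ... | false | true  | _     = ℚₚ.*-zeroʳ (weight x a b)
      ... | false | false | _     = refl

  handshake : ∀ c → ∑-arcs (λ u _ → w u * c) ≡ ℕ→ℚ N * (ℕ→ℚ Δ * c)
  handshake c = trans (sum-cong-≗ row-sum) (sum-const N (ℕ→ℚ Δ * c))
    where
    open +-*-Solver
    row-sum : ∀ u → ∑[ v < N ] (if A u v then w u * c else 0ℚ) ≡ ℕ→ℚ Δ * c
    row-sum u = trans (∑-neighbours-const u (w u * c))
      (trans (solve 3 (λ W C D → W :* C :* D := W :* D :* C) refl (w u) c (ℕ→ℚ (deg G u)))
             (cong (_* c) (w*deg≡Δ u)))

  ∑-arcs-weight-* : ∀ x c → ∑-arcs (λ a b → weight x a b * c) ≡ 2ℚ * (c * total G x)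
  ∑-arcs-weight-* x c = begin
    ∑∑ (arc (λ a b → weight x a b * c))   ≡⟨ ∑∑-cong scale ⟩
    ∑∑ (λ a b → c * arc (weight x) a b)   ≡⟨ ∑∑-*ˡ c (arc (weight x)) ⟨
    c * ∑-arcs (weight x)                 ≡⟨ cong (c *_) (2*total x) ⟨
    c * (2ℚ * total G x)                  ≡⟨ solve 2 (λ C T → C :* (con 2ℚ :* T) := con 2ℚ :* (C :* T)) refl c (total G x) ⟩
    2ℚ * (c * total G x)                  ∎
    where
    open ≡-Reasoning
    open +-*-Solver
    scale : ∀ a b → arc (λ a b → weight x a b * c) a b ≡ c * arc (weight x) a b
    scale a b with A a b
    ... | true  = ℚₚ.*-comm (weight x a b) c
    ... | false = sym (ℚₚ.*-zeroʳ c)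

  2Δ+1*bound : 2Δ+1 * bound Δ G ≡ ℕ→ℚ Δ * ℕ→ℚ N
  2Δ+1*bound = trans (sym (ℚₚ.*-assoc 2Δ+1 _ (ℕ→ℚ N))) (cong (_* ℕ→ℚ N) (ℕ→ℚ-*-/ Δ (Δ ℕ.+ Δ)))

  ∑-arcs-w*2 : ∑-arcs (λ u _ → w u * 2ℚ) ≡ 2ℚ * (2Δ+1 * bound Δ G)
  ∑-arcs-w*2 = trans (handshake 2ℚ) (trans (solve 3 (λ n d t → n :* (d :* t) := t :* (d :* n)) refl (ℕ→ℚ N) (ℕ→ℚ Δ) 2ℚ)
                                     (cong (2ℚ *_) (sym 2Δ+1*bound)))
    where open +-*-Solver

  module _ (x : Weighting G) (feasible : Feasible G x) where

    weight-nonNeg : ∀ {a b} → A a b ≡ true → 0ℚ ≤ weight x a b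
    weight-nonNeg {a} {b} a~b with ltᵇ a b in a<b | ltᵇ b a in b<a
    ... | true  | _     = proj₁ feasible (a , b) (∈-edges a<b a~b)
    ... | false | true  = proj₁ feasible (b , a) (∈-edges b<a (trans (A-sym b a) a~b))
    ... | false | false = ⊥-elim (adj⇒≢ a~b (ltᵇ-tri a b a<b b<a))

    ordered-δ-arcs≤2 : ∀ {p q} → ltᵇ p q ≡ true → A p q ≡ true → ∑-arcs (δ-weight x p q) ≤ 2ℚ
    ordered-δ-arcs≤2 {p} {q} p<q p~q = subst₂ _≤_ (2*δsum x p q) (ℚₚ.*-identityʳ 2ℚ)
      (*-monoˡ-≤ (ℚₚ.<⇒≤ 0<2) (proj₂ feasible (p , q) (∈-edges p<q p~q)))

    δ-arcs≤2 : ∀ {u v} → A u v ≡ true → ∑-arcs (δ-weight x u v) ≤ 2ℚ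
    δ-arcs≤2 {u} {v} u~v with ltᵇ u v in u<v | ltᵇ v u in v<u
    ... | true  | _     = ordered-δ-arcs≤2 u<v u~v
    ... | false | true  = subst (_≤ 2ℚ) (∑∑-cong (λ a b → cong (if A a b then_else 0ℚ) (δ-weight-swap a b)))
                                       (ordered-δ-arcs≤2 v<u (trans (A-sym v u) u~v))
      where
      δ-weight-swap : ∀ a b → δ-weight x v u a b ≡ δ-weight x u v a b
      δ-weight-swap a b = cong (if_then weight x a b else 0ℚ) (touches-flipˡ v u a b)
    ... | false | false = ⊥-elim (adj⇒≢ u~v (ltᵇ-tri u v u<v v<u))


    constraint-term-≤ : ∀ u v → arc (λ u v → w u * ∑-arcs (δ-weight x u v)) u v ≤ arc (λ u _ → w u * 2ℚ) u v
    constraint-term-≤ u v with A u v in u~v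
    ... | true  = *-monoˡ-≤ (w-nonNeg u) (δ-arcs≤2 u~v)
    ... | false = ℚₚ.≤-refl

    load-term-≤ : ∀ a b → arc (λ a b → weight x a b * 2Δ+1) a b ≤ arc (λ a b → weight x a b * load a b) a b
    load-term-≤ a b with A a b in a~b
    ... | true  = *-monoˡ-≤ (weight-nonNeg a~b) (2Δ+1≤load a~b)
    ... | false = ℚₚ.≤-refl

    chain : ∑-arcs (λ a b → weight x a b * 2Δ+1) ≤ ∑-arcs (λ a b → weight x a b * load a b)
          × ∑-arcs (λ a b → weight x a b * load a b) ≤ ∑-arcs (λ u _ → w u * 2ℚ)
    chain = ∑∑-mono-≤ load-term-≤ , subst (_≤ _) (exchange x) (∑∑-mono-≤ constraint-term-≤)

    total≤bound : total G x ≤ bound Δ G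
    total≤bound = *-cancelˡ-≤ (ℕ→ℚ-pos (Δ ℕ.+ Δ)) (*-cancelˡ-≤ 0<2 (begin
      2ℚ * (2Δ+1 * total G x)                       ≡⟨ ∑-arcs-weight-* x 2Δ+1 ⟨
      ∑-arcs (λ a b → weight x a b * 2Δ+1)          ≤⟨ proj₁ chain ⟩
      ∑-arcs (λ a b → weight x a b * load a b)      ≤⟨ proj₂ chain ⟩
      ∑-arcs (λ u _ → w u * 2ℚ)                     ≡⟨ ∑-arcs-w*2 ⟩
      2ℚ * (2Δ+1 * bound Δ G)                       ∎))
      where open ℚₚ.≤-Reasoning

    module _ (tight : total G x ≡ bound Δ G) where

      chain-tight : ∑-arcs (λ a b → weight x a b * 2Δ+1) ≡ ∑-arcs (λ a b → weight x a b * load a b)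
                  × ∑-arcs (λ a b → weight x a b * load a b) ≡ ∑-arcs (λ u _ → w u * 2ℚ)
      chain-tight = squeeze (proj₁ chain) (proj₂ chain)
        (trans (∑-arcs-weight-* x 2Δ+1) (trans (cong (λ t → 2ℚ * (2Δ+1 * t)) tight) (sym ∑-arcs-w*2)))

      tight-constraint : ∀ {u v} → A u v ≡ true → ∑-arcs (δ-weight x u v) ≡ 2ℚ
      tight-constraint {u} {v} u~v = *-cancelˡ-≡ (ℚₚ.<-≤-trans 0<1 (1≤w u))
        (trans (sym (arc-at (λ u v → w u * ∑-arcs (δ-weight x u v)) u~v))
        (trans (∑∑-≡⇒≡ constraint-term-≤ (trans (exchange x) (proj₂ chain-tight)) u v) (arc-at (λ u _ → w u * 2ℚ) u~v)))

      tight-load : ∀ {a b} → A a b ≡ true → 0ℚ < weight x a b → load a b ≡ 2Δ+1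
      tight-load {a} {b} a~b 0<x = sym (*-cancelˡ-≡ 0<x
        (trans (sym (arc-at (λ a b → weight x a b * 2Δ+1) a~b))
        (trans (∑∑-≡⇒≡ load-term-≤ (proj₁ chain-tight) a b) (arc-at (λ a b → weight x a b * load a b) a~b))))


module EqualityCase (G : Graph) (Δ : ℕ) (max-deg : MaxDegAtMost G Δ) (no-small : NoSmallComponent G)
  (x : Weighting G) (feasible : Feasible G x) (tight : total G x ≡ bound Δ G) where
  open import Data.Rational using (_≤_; _<_)
  open import Data.List.Membership.Propositional using (_∈_)
  open import Data.List.Relation.Unary.Any using (here; there)
  open import Data.List.Relation.Unary.All using ([]; _∷_)
  open import Data.List.Relation.Unary.AllPairs using (AllPairs; []; _∷_)
  open import Data.Rational.Solver using (module +-*-Solver)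
  open EdgeSums G
  open Connectivity G using (outer-neighbour; neighbour)
  open Spiders G
  open Loads G Δ max-deg no-small
  open UpperBound G Δ max-deg no-small

  arc-δ⁺ : ∀ u v a b → 0ℚ ≤ arc (δ-weight x u v) a b
  arc-δ⁺ = arc-δ-nonNeg x (weight-nonNeg x feasible)

  pendant-of-positive : ∀ {a b} → A a b ≡ true → 0ℚ < weight x a b →
    ∃[ ℓ ] ∃[ m ] ∃[ c ] PendantPath ℓ m c × deg G c ≡ Δ × ((a ≡ ℓ × b ≡ m) ⊎ (a ≡ m × b ≡ ℓ))
  pendant-of-positive {a} {b} a~b 0<x with outer-neighbour no-small a b
  ... | o , _ , inj₂ refl , b~o , o≢a , o≢b =
    let (P , deg-o) = tight-load⇒pendant a~b (ℚₚ.≤-reflexive (tight-load x feasible tight a~b 0<x)) b~o o≢a o≢b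
    in a , b , o , P , deg-o , inj₁ (refl , refl)
  ... | o , _ , inj₁ refl , a~o , o≢a , o≢b =
    let (P , deg-o) = tight-load⇒pendant (trans (A-sym b a) a~b)
                        (ℚₚ.≤-reflexive (trans (load-comm b a) (tight-load x feasible tight a~b 0<x))) a~o o≢b o≢a
    in b , a , o , P , deg-o , inj₂ (refl , refl)

  module OnPendant {ℓ m c} (P : PendantPath ℓ m c) where
    open PendantPath P

    δ-ℓm-support : ∀ a b → (a , b) ∈ (ℓ , m) ∷ (m , ℓ) ∷ (m , c) ∷ (c , m) ∷ [] ⊎ arc (δ-weight x ℓ m) a b ≡ 0ℚ
    δ-ℓm-support a b with A a b in a~b | touches ℓ m a b in t
    ... | false | _     = inj₂ refl
    ... | true  | false = inj₂ refl
    ... | true  | true  with touches-elim {ℓ} {m} {a} {b} t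
    ...   | inj₁ refl = inj₁ (here (cong (ℓ ,_) (leaf b a~b)))
    ...   | inj₂ (inj₁ refl) = inj₁ (there (here (cong (_, ℓ) (leaf a (trans (A-sym ℓ a) a~b)))))
    ...   | inj₂ (inj₂ (inj₁ refl)) with middle b a~b
    ...     | inj₁ b≡ℓ = inj₁ (there (here (cong (m ,_) b≡ℓ)))
    ...     | inj₂ b≡c = inj₁ (there (there (here (cong (m ,_) b≡c))))
    δ-ℓm-support a b | true | true | inj₂ (inj₂ (inj₂ refl)) with middle a (trans (A-sym m a) a~b)
    ...     | inj₁ a≡ℓ = inj₁ (here (cong (_, m) a≡ℓ))
    ...     | inj₂ a≡c = inj₁ (there (there (there (here (cong (_, m) a≡c)))))

    δ-ℓm≤ : ∑-arcs (δ-weight x ℓ m) ≤ 2ℚ * (weight x ℓ m + weight x m c)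
    δ-ℓm≤ = ℚₚ.≤-trans (∑∑-≤-support (arc-δ⁺ ℓ m) _ δ-ℓm-support) (ℚₚ.≤-reflexive (begin
      arc (δ-weight x ℓ m) ℓ m + (arc (δ-weight x ℓ m) m ℓ + (arc (δ-weight x ℓ m) m c + (arc (δ-weight x ℓ m) c m + 0ℚ)))
        ≡⟨ cong₂ _+_ (arc-δ-at x ℓ m ℓ~m (touches-intro {ℓ} {m} {ℓ} {m} (inj₁ refl)))
             (cong₂ _+_ (arc-δ-at x ℓ m m~ℓ (touches-intro {ℓ} {m} {m} {ℓ} (inj₂ (inj₁ refl))))
               (cong₂ _+_ (arc-δ-at x ℓ m m~c (touches-intro {ℓ} {m} {m} {c} (inj₂ (inj₂ (inj₁ refl)))))
                 (cong (_+ 0ℚ) (arc-δ-at x ℓ m c~m (touches-intro {ℓ} {m} {c} {m} (inj₂ (inj₂ (inj₂ refl)))))))) ⟩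
      weight x ℓ m + (weight x m ℓ + (weight x m c + (weight x c m + 0ℚ)))
        ≡⟨ cong₂ (λ s t → weight x ℓ m + (s + (weight x m c + (t + 0ℚ)))) (weight-comm x m ℓ) (weight-comm x c m) ⟩
      weight x ℓ m + (weight x ℓ m + (weight x m c + (weight x m c + 0ℚ)))
        ≡⟨ solve 2 (λ p q → p :+ (p :+ (q :+ (q :+ con 0ℚ))) := con 2ℚ :* (p :+ q)) refl (weight x ℓ m) (weight x m c) ⟩
      2ℚ * (weight x ℓ m + weight x m c) ∎))
      where
      open ≡-Reasoning
      open +-*-Solver

    1≤ℓm+mc : 1ℚ ≤ weight x ℓ m + weight x m c
    1≤ℓm+mc = *-cancelˡ-≤ 0<2 (subst (_≤ 2ℚ * (weight x ℓ m + weight x m c))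
                                     (trans (tight-constraint x feasible tight ℓ~m) (sym (ℚₚ.*-identityʳ 2ℚ))) δ-ℓm≤)

    module _ {z} (c~z : A c z ≡ true) (z≢m : z ≢ m) where

      z~c : A z c ≡ true
      z~c = trans (A-sym z c) c~z

      ℓ≢z : ℓ ≢ z
      ℓ≢z refl = m≢c (sym (leaf c z~c))

      leg-pairs : List (Fin N × Fin N)
      leg-pairs = (ℓ , m) ∷ (m , ℓ) ∷ (m , c) ∷ (c , m) ∷ (c , z) ∷ (z , c) ∷ []

      leg-pairs-distinct : AllPairs _≢_ leg-pairs
      leg-pairs-distinct =
          (≢-fst ℓ≢m ∷ ≢-fst ℓ≢m ∷ ≢-fst (c≢ℓ ∘ sym) ∷ ≢-fst (c≢ℓ ∘ sym) ∷ ≢-fst ℓ≢z ∷ [])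
        ∷ (≢-snd (c≢ℓ ∘ sym) ∷ ≢-fst m≢c ∷ ≢-fst m≢c ∷ ≢-fst (z≢m ∘ sym) ∷ [])
        ∷ (≢-fst m≢c ∷ ≢-fst m≢c ∷ ≢-fst (z≢m ∘ sym) ∷ [])
        ∷ (≢-snd (z≢m ∘ sym) ∷ ≢-fst (adj⇒≢ c~z) ∷ [])
        ∷ (≢-fst (adj⇒≢ c~z) ∷ [])
        ∷ [] ∷ []

      δ-mc-on-leg-pairs : ∑ₗ (uncurry (arc (δ-weight x m c))) leg-pairs
                          ≡ 2ℚ * (weight x ℓ m + weight x m c + weight x c z)
      δ-mc-on-leg-pairs = begin
        _ ≡⟨ cong₂ _+_ (arc-δ-at x m c ℓ~m (touches-intro {m} {c} {ℓ} {m} (inj₂ (inj₁ refl))))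
             (cong₂ _+_ (arc-δ-at x m c m~ℓ (touches-intro {m} {c} {m} {ℓ} (inj₁ refl)))
             (cong₂ _+_ (arc-δ-at x m c m~c (touches-intro {m} {c} {m} {c} (inj₁ refl)))
             (cong₂ _+_ (arc-δ-at x m c c~m (touches-intro {m} {c} {c} {m} (inj₂ (inj₁ refl))))
             (cong₂ _+_ (arc-δ-at x m c c~z (touches-intro {m} {c} {c} {z} (inj₂ (inj₂ (inj₁ refl)))))
             (cong (_+ 0ℚ) (arc-δ-at x m c z~c (touches-intro {m} {c} {z} {c} (inj₂ (inj₂ (inj₂ refl)))))))))) ⟩
        weight x ℓ m + (weight x m ℓ + (weight x m c + (weight x c m + (weight x c z + (weight x z c + 0ℚ)))))
          ≡⟨ cong₂ (λ p q → weight x ℓ m + (p + (weight x m c + (q + (weight x c z + (weight x z c + 0ℚ))))))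
                   (weight-comm x m ℓ) (weight-comm x c m) ⟩
        weight x ℓ m + (weight x ℓ m + (weight x m c + (weight x m c + (weight x c z + (weight x z c + 0ℚ)))))
          ≡⟨ cong (λ r → weight x ℓ m + (weight x ℓ m + (weight x m c + (weight x m c + (weight x c z + (r + 0ℚ))))))
                  (weight-comm x z c) ⟩
        weight x ℓ m + (weight x ℓ m + (weight x m c + (weight x m c + (weight x c z + (weight x c z + 0ℚ)))))
          ≡⟨ solve 3 (λ p q r → p :+ (p :+ (q :+ (q :+ (r :+ (r :+ con 0ℚ))))) := con 2ℚ :* (p :+ q :+ r)) refl
                   (weight x ℓ m) (weight x m c) (weight x c z) ⟩
        2ℚ * (weight x ℓ m + weight x m c + weight x c z) ∎
        where
        open ≡-Reasoning
        open +-*-Solver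

      -- The constraint at mc sees x_ℓm + x_mc, which is at least 1 by the constraint at ℓm, and x_cz.
      other-leg-zero : weight x c z ≡ 0ℚ
      other-leg-zero = ℚₚ.≤-antisym (+-cancelʳ-≤ {r = s} (subst₂ _≤_ (ℚₚ.+-comm s _) (sym (ℚₚ.+-identityˡ s))
                                                              (ℚₚ.≤-trans s+x≤1 1≤ℓm+mc)))
                                    (weight-nonNeg x feasible c~z)
        where
        s = weight x ℓ m + weight x m c
        s+x≤1 : s + weight x c z ≤ 1ℚ
        s+x≤1 = *-cancelˡ-≤ 0<2 (subst₂ _≤_ δ-mc-on-leg-pairs
                  (trans (tight-constraint x feasible tight m~c) (sym (ℚₚ.*-identityʳ 2ℚ)))
                  (∑∑-≥-distinct (arc-δ⁺ m c) leg-pairs-distinct))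

  positive-near : ∀ {u v} → A u v ≡ true → ∃[ a ] ∃[ b ] A a b ≡ true × touches u v a b ≡ true × 0ℚ < weight x a b
  positive-near {u} {v} u~v with ∑∑-pos (subst (0ℚ <_) (sym (tight-constraint x feasible tight u~v)) 0<2)
  ... | a , b , 0<arc with A a b in a~b | touches u v a b in t
  ...   | true  | true  = a , b , a~b , t , 0<arc
  ...   | true  | false = ⊥-elim (ℚₚ.<-irrefl refl 0<arc)
  ...   | false | _     = ⊥-elim (ℚₚ.<-irrefl refl 0<arc)

  touching-pendant : ∀ {u v a b ℓ m} → (a ≡ ℓ × b ≡ m) ⊎ (a ≡ m × b ≡ ℓ) → touches u v a b ≡ true → 0ℚ < weight x a b →
                     (u ≡ ℓ ⊎ u ≡ m ⊎ v ≡ ℓ ⊎ v ≡ m) × 0ℚ < weight x ℓ m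
  touching-pendant {u} {v} (inj₁ (refl , refl)) t 0<x = touches-elim {u} {v} t , 0<x
  touching-pendant {u} {v} {a} {b} (inj₂ (refl , refl)) t 0<x = swap (touches-elim {u} {v} t) , subst (0ℚ <_) (weight-comm x a b) 0<x
    where
    swap : u ≡ a ⊎ u ≡ b ⊎ v ≡ a ⊎ v ≡ b → u ≡ b ⊎ u ≡ a ⊎ v ≡ b ⊎ v ≡ a
    swap (inj₁ u≡a)                = inj₂ (inj₁ u≡a)
    swap (inj₂ (inj₁ u≡b))         = inj₁ u≡b
    swap (inj₂ (inj₂ (inj₁ v≡a))) = inj₂ (inj₂ (inj₂ v≡a))
    swap (inj₂ (inj₂ (inj₂ v≡b))) = inj₂ (inj₂ (inj₁ v≡b))

  pendant-near : ∀ {u v} → A u v ≡ true → ∃[ ℓ ] ∃[ m ] ∃[ c ] PendantPath ℓ m c × deg G c ≡ Δ ×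
                 (u ≡ ℓ ⊎ u ≡ m ⊎ v ≡ ℓ ⊎ v ≡ m) × 0ℚ < weight x ℓ m
  pendant-near u~v =
    let (a , b , a~b , t , 0<x) = positive-near u~v
        (ℓ , m , c , P , deg-c , orientation) = pendant-of-positive a~b 0<x
    in ℓ , m , c , P , deg-c , touching-pendant orientation t 0<x

  centre-of-pendant : ∀ {ℓ m c} → PendantPath ℓ m c → deg G c ≡ Δ → Centre Δ c
  centre-of-pendant {ℓ} {m} {c} P deg-c = record { degree = deg-c ; legs = legs }
    where
    open PendantPath P
    open OnPendant P using (other-leg-zero)

    leg-through : ∀ {z ℓ′ m′ c′} → A c z ≡ true → z ≢ m → PendantPath ℓ′ m′ c′ → 0ℚ < weight x ℓ′ m′ →
                  c ≡ ℓ′ ⊎ c ≡ m′ ⊎ z ≡ ℓ′ ⊎ z ≡ m′ → ∃[ ℓ″ ] PendantPath ℓ″ z c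
    leg-through {z} {ℓ′} {m′} c~z z≢m P′ 0<x near = leg near
      where
      module P′ = PendantPath P′
      c≢ℓ′ : c ≢ ℓ′
      c≢ℓ′ refl = z≢m (trans (P′.leaf z c~z) (sym (P′.leaf m c~m)))
      c≢m′ : c ≢ m′
      c≢m′ refl with P′.middle m c~m
      ... | inj₁ refl = c≢ℓ (sym (P′.leaf ℓ m~ℓ))
      ... | inj₂ refl with P′.middle z c~z
      ...   | inj₂ refl = z≢m refl
      ...   | inj₁ refl = ℚₚ.<-irrefl (sym (trans (weight-comm x z c) (other-leg-zero c~z z≢m))) 0<x
      leg : c ≡ ℓ′ ⊎ c ≡ m′ ⊎ z ≡ ℓ′ ⊎ z ≡ m′ → ∃[ ℓ″ ] PendantPath ℓ″ z c
      leg (inj₁ c≡ℓ′)                = ⊥-elim (c≢ℓ′ c≡ℓ′)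
      leg (inj₂ (inj₁ c≡m′))         = ⊥-elim (c≢m′ c≡m′)
      leg (inj₂ (inj₂ (inj₁ refl))) = ⊥-elim (c≢m′ (P′.leaf c (trans (A-sym z c) c~z)))
      leg (inj₂ (inj₂ (inj₂ refl))) with P′.middle c (trans (A-sym z c) c~z)
      ... | inj₁ c≡ℓ′ = ⊥-elim (c≢ℓ′ c≡ℓ′)
      ... | inj₂ refl = ℓ′ , P′

    legs : ∀ z → A c z ≡ true → ∃[ ℓ′ ] PendantPath ℓ′ z c
    legs z c~z with z Finₚ.≟ m
    ... | yes refl = ℓ , P
    ... | no z≢m = let (_ , _ , _ , P′ , _ , near , 0<x) = pendant-near c~z in leg-through c~z z≢m P′ 0<x near

  in-spider : ∀ {v y ℓ m c} → A v y ≡ true → PendantPath ℓ m c → v ≡ ℓ ⊎ v ≡ m ⊎ y ≡ ℓ ⊎ y ≡ m → InSpider c v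
  in-spider {v} {y} {ℓ} {m} {c} v~y P = near
    where
    open PendantPath P
    as-leaf : v ≡ ℓ → InSpider c v
    as-leaf refl = inj₂ (inj₂ (m , c~m , m~ℓ , c≢ℓ ∘ sym))
    as-middle : v ≡ m → InSpider c v
    as-middle refl = inj₂ (inj₁ c~m)
    near : v ≡ ℓ ⊎ v ≡ m ⊎ y ≡ ℓ ⊎ y ≡ m → InSpider c v
    near (inj₁ v≡ℓ)                = as-leaf v≡ℓ
    near (inj₂ (inj₁ v≡m))         = as-middle v≡m
    near (inj₂ (inj₂ (inj₁ refl))) = as-middle (leaf v (trans (A-sym y v) v~y))
    near (inj₂ (inj₂ (inj₂ refl))) with middle v (trans (A-sym y v) v~y)
    ... | inj₁ v≡ℓ = as-leaf v≡ℓ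
    ... | inj₂ v≡c = inj₁ v≡c

  spider-cover : SpiderCover Δ
  spider-cover v =
    let (y , v~y) = neighbour no-small v
        (_ , _ , c , P , deg-c , near , _) = pendant-near v~y
    in c , centre-of-pendant P deg-c , in-spider v~y P near


module TStar (Δ : ℕ) where
  open import Data.Fin using (_↑ˡ_; _↑ʳ_; splitAt)
  open import Data.Nat using (_<ᵇ_; _≡ᵇ_)

  data TStarVertex : Set where
    hub   : TStarVertex
    spoke : Fin Δ → TStarVertex
    tip   : Fin Δ → TStarVertex

  toFin : TStarVertex → Fin (tstarOrder Δ)
  toFin hub       = zero
  toFin (spoke i) = suc (i ↑ˡ Δ)
  toFin (tip i)   = suc (Δ ↑ʳ i)

  fromFin : Fin (tstarOrder Δ) → TStarVertex
  fromFin zero = hub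
  fromFin (suc j) with splitAt Δ j
  ... | inj₁ i = spoke i
  ... | inj₂ i = tip i

  fromFin-toFin : ∀ s → fromFin (toFin s) ≡ s
  fromFin-toFin hub = refl
  fromFin-toFin (spoke i) rewrite Finₚ.splitAt-↑ˡ Δ i Δ = refl
  fromFin-toFin (tip i) rewrite Finₚ.splitAt-↑ʳ Δ Δ i = refl

  toFin-fromFin : ∀ a → toFin (fromFin a) ≡ a
  toFin-fromFin zero = refl
  toFin-fromFin (suc j) with splitAt Δ j in e
  ... | inj₁ i = cong suc (Finₚ.splitAt⁻¹-↑ˡ e)
  ... | inj₂ i = cong suc (Finₚ.splitAt⁻¹-↑ʳ e)

  toFin-injective : ∀ {s t} → toFin s ≡ toFin t → s ≡ t
  toFin-injective {s} {t} e = trans (sym (fromFin-toFin s)) (trans (cong fromFin e) (fromFin-toFin t))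

  adjᵀ : TStarVertex → TStarVertex → Bool
  adjᵀ hub       (spoke _) = true
  adjᵀ (spoke _) hub       = true
  adjᵀ (spoke i) (tip j)   = i =ᵛ j
  adjᵀ (tip i)   (spoke j) = j =ᵛ i
  adjᵀ _         _         = false

  private
    T⇒≡true : ∀ {b} → T b → b ≡ true
    T⇒≡true = Equivalence.to Boolₚ.T-≡
      where open import Function using (Equivalence)

    <Δ⇒<ᵇ : ∀ {i} → i ℕ.< Δ → (i <ᵇ Δ) ≡ true
    <Δ⇒<ᵇ i<Δ = T⇒≡true (ℕₚ.<⇒<ᵇ i<Δ)

    Δ+j≮Δ : ∀ j → (Δ ℕ.+ j <ᵇ Δ) ≡ false
    Δ+j≮Δ j = Boolₚ.¬-not λ lt → ℕₚ.<-irrefl refl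
      (ℕₚ.<-≤-trans (ℕₚ.<ᵇ⇒< (Δ ℕ.+ j) Δ (subst T (sym lt) _)) (ℕₚ.m≤m+n Δ j))

    j≢i+Δ : ∀ {j} i → j ℕ.< Δ → (j ≡ᵇ i ℕ.+ Δ) ≡ false
    j≢i+Δ {j} i j<Δ = Boolₚ.¬-not λ eq → ℕₚ.<-irrefl refl
      (ℕₚ.<-≤-trans (subst (ℕ._< Δ) (ℕₚ.≡ᵇ⇒≡ j (i ℕ.+ Δ) (subst T (sym eq) _)) j<Δ) (ℕₚ.m≤n+m Δ i))

    Δ+a≡b+Δ : ∀ a b → (Δ ℕ.+ a ≡ᵇ b ℕ.+ Δ) ≡ (b ≡ᵇ a)
    Δ+a≡b+Δ a b with b ≡ᵇ a in b=a | Δ ℕ.+ a ≡ᵇ b ℕ.+ Δ in Δ+a=b+Δ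
    ... | true  | true  = refl
    ... | false | false = refl
    ... | true  | false = ⊥-elim (subst T Δ+a=b+Δ (ℕₚ.≡⇒≡ᵇ (Δ ℕ.+ a) (b ℕ.+ Δ)
            (trans (cong (Δ ℕ.+_) (sym (ℕₚ.≡ᵇ⇒≡ b a (subst T (sym b=a) _)))) (ℕₚ.+-comm Δ b))))
    ... | false | true  = ⊥-elim (subst T b=a (ℕₚ.≡⇒≡ᵇ b a (ℕₚ.+-cancelˡ-≡ Δ b a
            (trans (ℕₚ.+-comm Δ b) (sym (ℕₚ.≡ᵇ⇒≡ (Δ ℕ.+ a) (b ℕ.+ Δ) (subst T (sym Δ+a=b+Δ) _)))))))

  tstarAdj-toFin : ∀ s t → tstarAdjℕ Δ (toℕ (toFin s)) (toℕ (toFin t)) ≡ adjᵀ s t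
  tstarAdj-toFin hub hub = refl
  tstarAdj-toFin hub (spoke j) rewrite Finₚ.toℕ-↑ˡ j Δ | <Δ⇒<ᵇ (Finₚ.toℕ<n j) = refl
  tstarAdj-toFin hub (tip j) rewrite Finₚ.toℕ-↑ʳ Δ j | Δ+j≮Δ (toℕ j) = refl
  tstarAdj-toFin (spoke i) hub rewrite Finₚ.toℕ-↑ˡ i Δ | <Δ⇒<ᵇ (Finₚ.toℕ<n i) = refl
  tstarAdj-toFin (spoke i) (spoke j)
    rewrite Finₚ.toℕ-↑ˡ i Δ | Finₚ.toℕ-↑ˡ j Δ | <Δ⇒<ᵇ (Finₚ.toℕ<n i) | <Δ⇒<ᵇ (Finₚ.toℕ<n j)
          | j≢i+Δ (toℕ i) (Finₚ.toℕ<n j) | j≢i+Δ (toℕ j) (Finₚ.toℕ<n i) = refl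
  tstarAdj-toFin (spoke i) (tip j)
    rewrite Finₚ.toℕ-↑ˡ i Δ | Finₚ.toℕ-↑ʳ Δ j | <Δ⇒<ᵇ (Finₚ.toℕ<n i) | Δ+j≮Δ (toℕ j) | Δ+a≡b+Δ (toℕ j) (toℕ i)
    = Boolₚ.∨-identityʳ _
  tstarAdj-toFin (tip i) hub rewrite Finₚ.toℕ-↑ʳ Δ i | Δ+j≮Δ (toℕ i) = refl
  tstarAdj-toFin (tip i) (spoke j)
    rewrite Finₚ.toℕ-↑ʳ Δ i | Finₚ.toℕ-↑ˡ j Δ | Δ+j≮Δ (toℕ i) | <Δ⇒<ᵇ (Finₚ.toℕ<n j) | Δ+a≡b+Δ (toℕ i) (toℕ j) = refl
  tstarAdj-toFin (tip i) (tip j) rewrite Finₚ.toℕ-↑ʳ Δ i | Finₚ.toℕ-↑ʳ Δ j | Δ+j≮Δ (toℕ i) | Δ+j≮Δ (toℕ j) = refl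

  tstarAdj-fromFin : ∀ a b → tstarAdjℕ Δ (toℕ a) (toℕ b) ≡ adjᵀ (fromFin a) (fromFin b)
  tstarAdj-fromFin a b = trans (cong₂ (λ s t → tstarAdjℕ Δ (toℕ s) (toℕ t)) (sym (toFin-fromFin a)) (sym (toFin-fromFin b)))
                               (tstarAdj-toFin (fromFin a) (fromFin b))


module SpidersAreTStars (G : Graph) (Δ : ℕ) where
  open import Function using (Equivalence; mk⇔)
  open EdgeSums G using (N; A; A-sym; A-irrefl; adj⇒≢; =ᵛ-refl; =ᵛ⇒≡)
  open Connectivity G using (reach-trans)
  open Spiders G
  open TStar Δ

  module SpiderOf {c} (centre : Centre Δ c) where
    open Centre centre

    private
      enumeration = enumerate (A c) degree

    spokeᴳ : Fin Δ → Fin N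
    spokeᴳ = proj₁ enumeration

    c~spoke : ∀ i → A c (spokeᴳ i) ≡ true
    c~spoke = proj₁ (proj₂ enumeration)

    spoke-injective : ∀ {i j} → spokeᴳ i ≡ spokeᴳ j → i ≡ j
    spoke-injective = proj₁ (proj₂ (proj₂ enumeration))

    spoke-onto : ∀ {y} → A c y ≡ true → ∃[ i ] spokeᴳ i ≡ y
    spoke-onto {y} = proj₂ (proj₂ (proj₂ enumeration)) y

    tipᴳ : Fin Δ → Fin N
    tipᴳ i = proj₁ (legs (spokeᴳ i) (c~spoke i))

    leg : ∀ i → PendantPath (tipᴳ i) (spokeᴳ i) c
    leg i = proj₂ (legs (spokeᴳ i) (c~spoke i))

    module Leg i = PendantPath (leg i)

    embed : TStarVertex → Fin N
    embed hub       = c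
    embed (spoke i) = spokeᴳ i
    embed (tip i)   = tipᴳ i

    c≁tip : ∀ i → A c (tipᴳ i) ≡ false
    c≁tip i = Boolₚ.¬-not λ c~tip → adj⇒≢ (c~spoke i) (Leg.leaf i c (trans (A-sym (tipᴳ i) c) c~tip))

    spoke≁spoke : ∀ i j → A (spokeᴳ i) (spokeᴳ j) ≡ false
    spoke≁spoke i j = Boolₚ.¬-not λ si~sj → absurd (Leg.middle i (spokeᴳ j) si~sj)
      where
      absurd : spokeᴳ j ≡ tipᴳ i ⊎ spokeᴳ j ≡ c → ⊥
      absurd (inj₁ sj≡tip) = adj⇒≢ (c~spoke i) (Leg.leaf i c (subst (λ t → A t c ≡ true) sj≡tip (Leg.m~c j)))
      absurd (inj₂ sj≡c)   = adj⇒≢ (c~spoke j) (sym sj≡c)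

    spoke~tip : ∀ i j → A (spokeᴳ i) (tipᴳ j) ≡ (i =ᵛ j)
    spoke~tip i j with i =ᵛ j in i=j
    ... | true with =ᵛ⇒≡ {a = i} {b = j} i=j
    ...   | refl = Leg.m~ℓ i
    spoke~tip i j | false = Boolₚ.¬-not λ si~tj → false≢true (trans (sym i=j)
      (subst (λ t → (i =ᵛ t) ≡ true) (spoke-injective (Leg.leaf j (spokeᴳ i) (trans (A-sym (tipᴳ j) (spokeᴳ i)) si~tj))) (=ᵛ-refl i)))

    tip≁tip : ∀ i j → A (tipᴳ i) (tipᴳ j) ≡ false
    tip≁tip i j = Boolₚ.¬-not λ ti~tj → adj⇒≢ (c~spoke j) (Leg.leaf j c (subst (λ t → A t c ≡ true) (sym (Leg.leaf i (tipᴳ j) ti~tj)) (Leg.m~c i)))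

    embed-adj : ∀ s t → A (embed s) (embed t) ≡ adjᵀ s t
    embed-adj hub       hub       = A-irrefl c
    embed-adj hub       (spoke j) = c~spoke j
    embed-adj hub       (tip j)   = c≁tip j
    embed-adj (spoke i) hub       = Leg.m~c i
    embed-adj (spoke i) (spoke j) = spoke≁spoke i j
    embed-adj (spoke i) (tip j)   = spoke~tip i j
    embed-adj (tip i)   hub       = trans (A-sym (tipᴳ i) c) (c≁tip i)
    embed-adj (tip i)   (spoke j) = trans (A-sym (tipᴳ i) (spokeᴳ j)) (spoke~tip j i)
    embed-adj (tip i)   (tip j)   = tip≁tip i j

    embed-injective : ∀ {s t} → embed s ≡ embed t → s ≡ t
    embed-injective {hub}     {hub}     _ = refl
    embed-injective {hub}     {spoke j} e = ⊥-elim (adj⇒≢ (c~spoke j) e)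
    embed-injective {hub}     {tip j}   e = ⊥-elim (Leg.c≢ℓ j e)
    embed-injective {spoke i} {hub}     e = ⊥-elim (adj⇒≢ (c~spoke i) (sym e))
    embed-injective {spoke i} {spoke j} e = cong spoke (spoke-injective e)
    embed-injective {spoke i} {tip j}   e = ⊥-elim (adj⇒≢ (c~spoke j) (Leg.leaf j c (subst (λ t → A t c ≡ true) e (Leg.m~c i))))
    embed-injective {tip i}   {hub}     e = ⊥-elim (Leg.c≢ℓ i (sym e))
    embed-injective {tip i}   {spoke j} e = ⊥-elim (adj⇒≢ (c~spoke i) (Leg.leaf i c (subst (λ t → A t c ≡ true) (sym e) (Leg.m~c j))))
    embed-injective {tip i}   {tip j}   e = cong tip (spoke-injective (sym (Leg.leaf i (spokeᴳ j) (subst (λ t → A t (spokeᴳ j) ≡ true) (sym e) (Leg.ℓ~m j)))))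

    InSpider-step : ∀ {u u′} → InSpider c u → A u u′ ≡ true → InSpider c u′
    InSpider-step (inj₁ refl) u~u′ = inj₂ (inj₁ u~u′)
    InSpider-step {u′ = u′} (inj₂ (inj₁ c~u)) u~u′ with spoke-onto c~u
    ... | i , refl with Leg.middle i u′ u~u′
    ...   | inj₁ refl = inj₂ (inj₂ (spokeᴳ i , c~spoke i , Leg.m~ℓ i , Leg.c≢ℓ i ∘ sym))
    ...   | inj₂ refl = inj₁ refl
    InSpider-step {u} {u′} (inj₂ (inj₂ (z , c~z , z~u , u≢c))) u~u′ with spoke-onto c~z
    ... | i , refl with Leg.middle i u z~u
    ...   | inj₂ u≡c  = ⊥-elim (u≢c u≡c)
    ...   | inj₁ refl = inj₂ (inj₁ (subst (λ t → A c t ≡ true) (sym (Leg.leaf i u′ u~u′)) (c~spoke i)))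

    InSpider-reach : ∀ {v u} → InSpider c v → Reach G v u → InSpider c u
    InSpider-reach v∈S here       = v∈S
    InSpider-reach v∈S (step e r) = InSpider-reach (InSpider-step v∈S e) r

    InSpider⇒embed : ∀ {u} → InSpider c u → ∃[ s ] embed s ≡ u
    InSpider⇒embed (inj₁ refl) = hub , refl
    InSpider⇒embed (inj₂ (inj₁ c~u)) = let (i , e) = spoke-onto c~u in spoke i , e
    InSpider⇒embed {u} (inj₂ (inj₂ (z , c~z , z~u , u≢c))) with spoke-onto c~z
    ... | i , refl with Leg.middle i u z~u
    ...   | inj₁ u≡tip = tip i , sym u≡tip
    ...   | inj₂ u≡c   = ⊥-elim (u≢c u≡c)

    InSpider⇒reach-hub : ∀ {v} → InSpider c v → Reach G v c
    InSpider⇒reach-hub (inj₁ refl) = here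
    InSpider⇒reach-hub {v} (inj₂ (inj₁ c~v)) = step (trans (A-sym v c) c~v) here
    InSpider⇒reach-hub {v} (inj₂ (inj₂ (z , c~z , z~v , _))) = step (trans (A-sym v z) z~v) (step (trans (A-sym z c) c~z) here)

    hub-reach : ∀ s → Reach G c (embed s)
    hub-reach hub       = here
    hub-reach (spoke i) = step (c~spoke i) here
    hub-reach (tip i)   = step (c~spoke i) (step (Leg.m~ℓ i) here)

    component-iso : ∀ {v} → InSpider c v → ComponentIsoTstar Δ G v
    component-iso {v} v∈S = embed ∘ fromFin , injective , (λ u → mk⇔ (covers u) (reached u)) , adjacency
      where
      injective : ∀ a b → embed (fromFin a) ≡ embed (fromFin b) → a ≡ b
      injective a b e = trans (sym (toFin-fromFin a)) (trans (cong toFin (embed-injective e)) (toFin-fromFin b))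
      covers : ∀ u → Reach G v u → ∃[ a ] embed (fromFin a) ≡ u
      covers u r = let (s , e) = InSpider⇒embed (InSpider-reach v∈S r) in toFin s , trans (cong embed (fromFin-toFin s)) e
      reached : ∀ u → (∃[ a ] embed (fromFin a) ≡ u) → Reach G v u
      reached u (a , refl) = reach-trans (InSpider⇒reach-hub v∈S) (hub-reach (fromFin a))
      adjacency : ∀ a b → adj G (embed (fromFin a)) (embed (fromFin b)) ≡ tstarAdjℕ Δ (toℕ a) (toℕ b)
      adjacency a b = trans (embed-adj (fromFin a) (fromFin b)) (sym (tstarAdj-fromFin a b))

  spider⇒tstar : SpiderCover Δ → AllComponentsTstar Δ G
  spider⇒tstar cover v = let (c , centre , v∈S) = cover v in SpiderOf.component-iso centre v∈S

  module TStarComponent {v} (iso : ComponentIsoTstar Δ G v) where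
    private
      f = proj₁ iso
      f-injective = proj₁ (proj₂ iso)
      reach⇔image = proj₁ (proj₂ (proj₂ iso))
      f-adj = proj₂ (proj₂ (proj₂ iso))

    embed : TStarVertex → Fin N
    embed s = f (toFin s)

    embed-injective : ∀ {s t} → embed s ≡ embed t → s ≡ t
    embed-injective e = toFin-injective (f-injective _ _ e)

    embed-adj : ∀ s t → A (embed s) (embed t) ≡ adjᵀ s t
    embed-adj s t = trans (f-adj (toFin s) (toFin t)) (tstarAdj-toFin s t)

    reach⇒embed : ∀ {u} → Reach G v u → ∃[ s ] embed s ≡ u
    reach⇒embed {u} r = let (a , e) = Equivalence.to (reach⇔image u) r in fromFin a , trans (cong f (toFin-fromFin a)) e

    neighbour-of : ∀ s {y} → A (embed s) y ≡ true → ∃[ t ] embed t ≡ y × adjᵀ s t ≡ true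
    neighbour-of s {y} s~y with reach⇒embed (reach-trans (Equivalence.from (reach⇔image (embed s)) (toFin s , refl)) (step s~y here))
    ... | t , refl = t , refl , trans (sym (embed-adj s t)) s~y

    hub-centre : Centre Δ (embed hub)
    hub-centre = record { degree = degree ; legs = legs }
      where
      spoke-injective : ∀ {i j} → spoke i ≡ spoke j → i ≡ j
      spoke-injective refl = refl
      degree : deg G (embed hub) ≡ Δ
      degree = count-≡ N Δ (A (embed hub)) (embed ∘ spoke) (spoke-injective ∘ embed-injective) onto (λ i → embed-adj hub (spoke i))
        where
        onto : ∀ y → A (embed hub) y ≡ true → ∃[ i ] embed (spoke i) ≡ y
        onto y hub~y with neighbour-of hub hub~y
        ... | spoke i , e , _ = i , e
        ... | hub     , _ , ()
        ... | tip _   , _ , ()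
      legs : ∀ z → A (embed hub) z ≡ true → ∃[ ℓ ] PendantPath ℓ z (embed hub)
      legs z hub~z with neighbour-of hub hub~z
      ... | hub     , _ , ()
      ... | tip _   , _ , ()
      ... | spoke i , refl , _ = embed (tip i) , record
        { ℓ~m    = trans (embed-adj (tip i) (spoke i)) (=ᵛ-refl i)
        ; leaf   = leaf
        ; m~c    = embed-adj (spoke i) hub
        ; c≢ℓ    = λ e → hub≢tip (embed-injective e)
        ; middle = middle }
        where
        hub≢tip : hub ≢ tip i
        hub≢tip ()
        leaf : ∀ y → A (embed (tip i)) y ≡ true → y ≡ embed (spoke i)
        leaf y tip~y with neighbour-of (tip i) tip~y
        ... | spoke j , refl , i=j = cong (embed ∘ spoke) (=ᵛ⇒≡ i=j)
        ... | hub     , _ , ()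
        ... | tip _   , _ , ()
        middle : ∀ y → A (embed (spoke i)) y ≡ true → y ≡ embed (tip i) ⊎ y ≡ embed hub
        middle y spoke~y with neighbour-of (spoke i) spoke~y
        ... | hub     , refl , _   = inj₂ refl
        ... | tip j   , refl , i=j = inj₁ (cong (embed ∘ tip) (sym (=ᵛ⇒≡ i=j)))
        ... | spoke _ , _ , ()

    v-in-spider : InSpider (embed hub) v
    v-in-spider with reach⇒embed {v} here
    ... | hub     , e = inj₁ (sym e)
    ... | spoke i , e = inj₂ (inj₁ (subst (λ t → A (embed hub) t ≡ true) e (embed-adj hub (spoke i))))
    ... | tip i   , e = inj₂ (inj₂ (embed (spoke i) , embed-adj hub (spoke i)
                                , subst (λ t → A (embed (spoke i)) t ≡ true) e (trans (embed-adj (spoke i) (tip i)) (=ᵛ-refl i))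
                                , λ v≡hub → hub≢tip (embed-injective (trans (sym v≡hub) (sym e)))))
      where
      hub≢tip : hub ≢ tip i
      hub≢tip ()

  tstar⇒spider : AllComponentsTstar Δ G → SpiderCover Δ
  tstar⇒spider all-tstar v = embed hub , hub-centre , v-in-spider
    where open TStarComponent (all-tstar v)


module PendantWeighting (G : Graph) (Δ : ℕ) (max-deg : MaxDegAtMost G Δ) (no-small : NoSmallComponent G) (cover : Spiders.SpiderCover G Δ) where
  open import Data.Rational using (_≤_)
  open import Data.Sum using (map₂)
  open import Data.List.Membership.Propositional using (_∈_)
  open import Data.List.Relation.Unary.Any using (here; there)
  open import Data.List.Relation.Unary.All using ([]; _∷_)
  open import Data.List.Relation.Unary.AllPairs using ([]; _∷_)
  open import Function using (Equivalence)
  open EdgeSums G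
  open Connectivity G using (neighbour)
  open Spiders G
  open Loads G Δ max-deg no-small
  open UpperBound G Δ max-deg no-small

  2≤Δ : ∀ {c} → Centre Δ c → 2 ℕ.≤ Δ
  2≤Δ {c} centre = let (z , c~z) = neighbour no-small c ; (_ , P) = Centre.legs centre z c~z
                   in subst (ℕ._≤ Δ) (PendantPath.deg-m P) (max-deg z)

  data Role (u : Fin N) : Set where
    hub-of   : Centre Δ u → Role u
    spoke-of : ∀ {ℓ c} → Centre Δ c → PendantPath ℓ u c → Role u
    tip-of   : ∀ {m c} → Centre Δ c → PendantPath u m c → Role u

  role : ∀ u → Role u
  role u with cover u
  ... | c , centre , inj₁ refl = hub-of centre
  ... | c , centre , inj₂ (inj₁ c~u) = spoke-of centre (proj₂ (Centre.legs centre u c~u))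
  ... | c , centre , inj₂ (inj₂ (z , c~z , z~u , u≢c)) with Centre.legs centre z c~z
  ...   | ℓ , P with PendantPath.middle P u z~u
  ...     | inj₁ refl = tip-of centre P
  ...     | inj₂ u≡c  = ⊥-elim (u≢c u≡c)

  deg≡1⇒tip : ∀ {u} → deg G u ≡ 1 → ∃[ m ] ∃[ c ] Centre Δ c × PendantPath u m c
  deg≡1⇒tip {u} deg≡1 with role u
  ... | hub-of centre  = ⊥-elim (ℕₚ.<-irrefl refl (subst (2 ℕ.≤_) (trans (sym (Centre.degree centre)) deg≡1) (2≤Δ centre)))
  ... | spoke-of _ P   = ⊥-elim (ℕₚ.1+n≢n (trans (sym (PendantPath.deg-m P)) deg≡1))
  ... | tip-of centre P = _ , _ , centre , P

  leg-of-edge : ∀ {u v} → A u v ≡ true → ∃[ ℓ ] ∃[ m ] ∃[ c ] Centre Δ c × PendantPath ℓ m c × (u ≡ m ⊎ v ≡ m)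
  leg-of-edge {u} {v} u~v with role u
  ... | hub-of centre = let (ℓ , P) = Centre.legs centre v u~v in ℓ , v , u , centre , P , inj₂ refl
  ... | spoke-of centre P = _ , u , _ , centre , P , inj₁ refl
  ... | tip-of centre P = u , _ , _ , centre , P , inj₂ (PendantPath.leaf P v u~v)

  isTip : Fin N → Bool
  isTip u = deg G u ℕ.≡ᵇ 1

  isTip⇒deg≡1 : ∀ {u} → isTip u ≡ true → deg G u ≡ 1
  isTip⇒deg≡1 {u} t = ℕₚ.≡ᵇ⇒≡ (deg G u) 1 (Equivalence.from Boolₚ.T-≡ t)

  x₀ : Weighting G
  x₀ a b = 𝟙 (isTip a ∨ isTip b)

  weight-x₀ : ∀ a b → weight x₀ a b ≡ x₀ a b
  weight-x₀ a b with ltᵇ a b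
  ... | true  = refl
  ... | false = cong 𝟙 (Boolₚ.∨-comm (isTip b) (isTip a))

  weight-x₀-nonNeg : ∀ {a b} → A a b ≡ true → 0ℚ ≤ weight x₀ a b
  weight-x₀-nonNeg {a} {b} _ = subst (0ℚ ≤_) (sym (weight-x₀ a b)) (𝟙-nonNeg _)

  module OnLeg {ℓ m c} (centre : Centre Δ c) (P : PendantPath ℓ m c) where
    open PendantPath P

    isTip-ℓ : isTip ℓ ≡ true
    isTip-ℓ = Equivalence.to Boolₚ.T-≡ (ℕₚ.≡⇒≡ᵇ (deg G ℓ) 1 deg-ℓ)

    x₀-leg : weight x₀ ℓ m ≡ 1ℚ
    x₀-leg = trans (weight-x₀ ℓ m) (cong (λ t → 𝟙 (t ∨ isTip m)) isTip-ℓ)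

    deg-m≢1 : deg G m ≢ 1
    deg-m≢1 e = ℕₚ.1+n≢n (trans (sym deg-m) e)

    deg-c≢1 : deg G c ≢ 1
    deg-c≢1 e = ℕₚ.<-irrefl refl (subst (2 ℕ.≤_) (trans (sym (Centre.degree centre)) e) (2≤Δ centre))

    deg-spoke≢1 : ∀ {z} → A c z ≡ true → deg G z ≢ 1
    deg-spoke≢1 {z} c~z e = let (_ , P′) = Centre.legs centre z c~z in ℕₚ.1+n≢n (trans (sym (PendantPath.deg-m P′)) e)

    tip-in-leg : ∀ {a b} → A a b ≡ true → deg G a ≡ 1 → a ≡ m ⊎ a ≡ ℓ ⊎ a ≡ c → a ≡ ℓ × b ≡ m
    tip-in-leg a~b deg-a≡1 (inj₁ refl)        = ⊥-elim (deg-m≢1 deg-a≡1)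
    tip-in-leg a~b deg-a≡1 (inj₂ (inj₁ refl)) = refl , leaf _ a~b
    tip-in-leg a~b deg-a≡1 (inj₂ (inj₂ refl)) = ⊥-elim (deg-c≢1 deg-a≡1)

    tip-beside-leg : ∀ {a b} → A a b ≡ true → deg G a ≡ 1 → b ≡ m ⊎ b ≡ ℓ ⊎ b ≡ c → a ≡ ℓ × b ≡ m
    tip-beside-leg {a} a~b deg-a≡1 (inj₁ refl) with middle a (trans (A-sym m a) a~b)
    ... | inj₁ a≡ℓ  = a≡ℓ , refl
    ... | inj₂ refl = ⊥-elim (deg-c≢1 deg-a≡1)
    tip-beside-leg {a} a~b deg-a≡1 (inj₂ (inj₁ refl)) with leaf a (trans (A-sym ℓ a) a~b)
    ... | refl = ⊥-elim (deg-m≢1 deg-a≡1)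
    tip-beside-leg {a} a~b deg-a≡1 (inj₂ (inj₂ refl)) = ⊥-elim (deg-spoke≢1 (trans (A-sym c a) a~b) deg-a≡1)

    endpoint-in-leg : ∀ {u v t} → A u v ≡ true → u ≡ m ⊎ v ≡ m → t ≡ u ⊎ t ≡ v → t ≡ m ⊎ t ≡ ℓ ⊎ t ≡ c
    endpoint-in-leg u~v       (inj₁ u≡m)  (inj₁ t≡u)  = inj₁ (trans t≡u u≡m)
    endpoint-in-leg u~v       (inj₁ refl) (inj₂ refl) = inj₂ (middle _ u~v)
    endpoint-in-leg {u} u~v   (inj₂ refl) (inj₁ refl) = inj₂ (middle u (trans (A-sym m u) u~v))
    endpoint-in-leg u~v       (inj₂ v≡m)  (inj₂ t≡v)  = inj₁ (trans t≡v v≡m)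

    module _ {u v} (u~v : A u v ≡ true) (m∈uv : u ≡ m ⊎ v ≡ m) where

      tip-arc : ∀ {a b} → A a b ≡ true → touches u v a b ≡ true → deg G a ≡ 1 → a ≡ ℓ × b ≡ m
      tip-arc {a} {b} a~b t deg-a≡1 with touches-elim {u} {v} {a} {b} t
      ... | inj₁ u≡a               = tip-in-leg a~b deg-a≡1 (endpoint-in-leg u~v m∈uv (inj₁ (sym u≡a)))
      ... | inj₂ (inj₁ u≡b)        = tip-beside-leg a~b deg-a≡1 (endpoint-in-leg u~v m∈uv (inj₁ (sym u≡b)))
      ... | inj₂ (inj₂ (inj₁ v≡a)) = tip-in-leg a~b deg-a≡1 (endpoint-in-leg u~v m∈uv (inj₂ (sym v≡a)))
      ... | inj₂ (inj₂ (inj₂ v≡b)) = tip-beside-leg a~b deg-a≡1 (endpoint-in-leg u~v m∈uv (inj₂ (sym v≡b)))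

      tip-arcs : ∀ {a b} → A a b ≡ true → touches u v a b ≡ true → ∀ p q → isTip a ≡ p → isTip b ≡ q →
                 (a , b) ∈ (m , ℓ) ∷ (ℓ , m) ∷ [] ⊎ 𝟙 (p ∨ q) ≡ 0ℚ
      tip-arcs a~b t true  _     tip-a _ =
        let (a≡ℓ , b≡m) = tip-arc a~b t (isTip⇒deg≡1 tip-a) in inj₁ (there (here (cong₂ _,_ a≡ℓ b≡m)))
      tip-arcs {a} {b} a~b t false true  _ tip-b =
        let (b≡ℓ , a≡m) = tip-arc (trans (A-sym b a) a~b) (trans (touches-flipʳ u v b a) t) (isTip⇒deg≡1 tip-b)
        in inj₁ (here (cong₂ _,_ a≡m b≡ℓ))
      tip-arcs a~b t false false _ _ = inj₂ refl

      δ-x₀-support : ∀ a b → (a , b) ∈ (m , ℓ) ∷ (ℓ , m) ∷ [] ⊎ arc (δ-weight x₀ u v) a b ≡ 0ℚ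
      δ-x₀-support a b with A a b in a~b | touches u v a b in t
      ... | false | _     = inj₂ refl
      ... | true  | false = inj₂ refl
      ... | true  | true  = map₂ (trans (weight-x₀ a b)) (tip-arcs a~b t (isTip a) (isTip b) refl refl)

      touches-mℓ : touches u v m ℓ ≡ true
      touches-mℓ = touches-intro {u} {v} {m} {ℓ} (m-first m∈uv)
        where
        m-first : u ≡ m ⊎ v ≡ m → u ≡ m ⊎ u ≡ ℓ ⊎ v ≡ m ⊎ v ≡ ℓ
        m-first (inj₁ u≡m) = inj₁ u≡m
        m-first (inj₂ v≡m) = inj₂ (inj₂ (inj₁ v≡m))

      touches-ℓm : touches u v ℓ m ≡ true
      touches-ℓm = touches-intro {u} {v} {ℓ} {m} (m-second m∈uv)
        where
        m-second : u ≡ m ⊎ v ≡ m → u ≡ ℓ ⊎ u ≡ m ⊎ v ≡ ℓ ⊎ v ≡ m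
        m-second (inj₁ u≡m) = inj₂ (inj₁ u≡m)
        m-second (inj₂ v≡m) = inj₂ (inj₂ (inj₂ v≡m))

      leg-arcs : ∑ₗ (uncurry (arc (δ-weight x₀ u v))) ((m , ℓ) ∷ (ℓ , m) ∷ []) ≡ 2ℚ
      leg-arcs = cong₂ _+_ (trans (arc-δ-at x₀ u v m~ℓ touches-mℓ) (trans (weight-comm x₀ m ℓ) x₀-leg))
                           (trans (cong (_+ 0ℚ) (trans (arc-δ-at x₀ u v ℓ~m touches-ℓm) x₀-leg)) (ℚₚ.+-identityʳ 1ℚ))

      δ-x₀≡2 : ∑-arcs (δ-weight x₀ u v) ≡ 2ℚ
      δ-x₀≡2 = ℚₚ.≤-antisym
        (subst (_ ≤_) leg-arcs (∑∑-≤-support (arc-δ-nonNeg x₀ weight-x₀-nonNeg u v) _ δ-x₀-support))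
        (subst (_≤ _) leg-arcs (∑∑-≥-distinct (arc-δ-nonNeg x₀ weight-x₀-nonNeg u v) ((≢-fst (ℓ≢m ∘ sym) ∷ []) ∷ [] ∷ [])))

    row-outside-leg : ∀ u → u ∈ ℓ ∷ m ∷ c ∷ [] ⊎ row u ℓ m ≡ 0ℚ
    row-outside-leg u with u Finₚ.≟ ℓ | u Finₚ.≟ m | u Finₚ.≟ c
    ... | yes u≡ℓ | _       | _       = inj₁ (here u≡ℓ)
    ... | no _    | yes u≡m | _       = inj₁ (there (here u≡m))
    ... | no _    | no _    | yes u≡c = inj₁ (there (there (here u≡c)))
    ... | no u≢ℓ  | no u≢m  | no u≢c  = inj₂ (trans (sum-cong-≗ vanish) (sum-replicate-zero N))
      where
      vanish : ∀ v → arc (load-term ℓ m) u v ≡ 0ℚ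
      vanish v with A u v in u~v | touches u v ℓ m in t
      ... | false | _     = refl
      ... | true  | false = ℚₚ.*-zeroʳ (w u)
      ... | true  | true  with touches-elim {u} {v} {ℓ} {m} t
      ...   | inj₁ u≡ℓ               = ⊥-elim (u≢ℓ u≡ℓ)
      ...   | inj₂ (inj₁ u≡m)        = ⊥-elim (u≢m u≡m)
      ...   | inj₂ (inj₂ (inj₁ refl)) = ⊥-elim (u≢m (leaf u (trans (A-sym ℓ u) u~v)))
      ...   | inj₂ (inj₂ (inj₂ refl)) with middle u (trans (A-sym m u) u~v)
      ...     | inj₁ u≡ℓ = ⊥-elim (u≢ℓ u≡ℓ)
      ...     | inj₂ u≡c = ⊥-elim (u≢c u≡c)

    row-hub≤1 : row c ℓ m ≤ 1ℚ
    row-hub≤1 = ℚₚ.≤-trans (∑₁.∑-≤-support (arc-load-term-nonNeg ℓ m c) (m ∷ []) only-m) (ℚₚ.≤-reflexive (begin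
      arc (load-term ℓ m) c m + 0ℚ   ≡⟨ ℚₚ.+-identityʳ _ ⟩
      arc (load-term ℓ m) c m        ≡⟨ arc-load-term-at c~m (touches-intro {c} {m} {ℓ} {m} (inj₂ (inj₂ (inj₂ refl)))) ⟩
      w c                            ≡⟨ deg≡Δ⇒w≡1 c (Centre.degree centre) ⟩
      1ℚ                             ∎))
      where
      open ≡-Reasoning
      only-m : ∀ v → v ∈ m ∷ [] ⊎ arc (load-term ℓ m) c v ≡ 0ℚ
      only-m v with A c v in c~v | touches c v ℓ m in t
      ... | false | _     = inj₂ refl
      ... | true  | false = inj₂ (ℚₚ.*-zeroʳ (w c))
      ... | true  | true  with touches-elim {c} {v} {ℓ} {m} t
      ...   | inj₁ c≡ℓ               = ⊥-elim (c≢ℓ c≡ℓ)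
      ...   | inj₂ (inj₁ c≡m)        = ⊥-elim (m≢c (sym c≡m))
      ...   | inj₂ (inj₂ (inj₁ refl)) = ⊥-elim (m≢c (sym (leaf c (trans (A-sym ℓ c) c~v))))
      ...   | inj₂ (inj₂ (inj₂ v≡m)) = inj₁ (here v≡m)

    load-leg≤ : load ℓ m ≤ 2Δ+1
    load-leg≤ = begin
      load ℓ m                                       ≤⟨ ∑₁.∑-≤-support (λ u → row-nonNeg u ℓ m) (ℓ ∷ m ∷ c ∷ []) row-outside-leg ⟩
      row ℓ ℓ m + (row m ℓ m + (row c ℓ m + 0ℚ))     ≡⟨ cong₂ (λ p q → p + (q + (row c ℓ m + 0ℚ))) (row-endpoint (inj₁ refl)) (row-endpoint (inj₂ refl)) ⟩
      ℕ→ℚ Δ + (ℕ→ℚ Δ + (row c ℓ m + 0ℚ))             ≤⟨ ℚₚ.+-monoʳ-≤ (ℕ→ℚ Δ) (ℚₚ.+-monoʳ-≤ (ℕ→ℚ Δ) (subst (_≤ 1ℚ) (sym (ℚₚ.+-identityʳ _)) row-hub≤1)) ⟩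
      ℕ→ℚ Δ + (ℕ→ℚ Δ + 1ℚ)                           ≡⟨ ℚₚ.+-assoc (ℕ→ℚ Δ) (ℕ→ℚ Δ) 1ℚ ⟨
      ℕ→ℚ Δ + ℕ→ℚ Δ + 1ℚ                             ≡⟨ 2Δ+1≡Δ+Δ+1 ⟨
      2Δ+1                                           ∎
      where open ℚₚ.≤-Reasoning

  δ-x₀≡2 : ∀ {u v} → A u v ≡ true → ∑-arcs (δ-weight x₀ u v) ≡ 2ℚ
  δ-x₀≡2 u~v = let (_ , _ , _ , centre , P , m∈uv) = leg-of-edge u~v in OnLeg.δ-x₀≡2 centre P u~v m∈uv

  x₀-feasible : Feasible G x₀
  x₀-feasible = (λ _ _ → 𝟙-nonNeg _) , constraint
    where
    constraint : ∀ e → e ∈ edges G → δsum G x₀ e ≤ 1ℚ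
    constraint (u , v) uv∈E = ℚₚ.≤-reflexive (*-cancelˡ-≡ 0<2
      (trans (2*δsum x₀ u v) (trans (δ-x₀≡2 (∈-edges⁻ uv∈E)) (sym (ℚₚ.*-identityʳ 2ℚ)))))

  x₀-load-term-≤ : ∀ a b → arc (λ a b → weight x₀ a b * load a b) a b ≤ arc (λ a b → weight x₀ a b * 2Δ+1) a b
  x₀-load-term-≤ a b with A a b in a~b
  ... | false = ℚₚ.≤-refl
  ... | true rewrite weight-x₀ a b with isTip a in tip-a | isTip b in tip-b
  ...   | true  | _     = let (_ , _ , centre , P) = deg≡1⇒tip (isTip⇒deg≡1 tip-a)
                          in *-monoˡ-≤ 0≤1 (subst (λ t → load a t ≤ 2Δ+1) (sym (PendantPath.leaf P b a~b)) (OnLeg.load-leg≤ centre P))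
  ...   | false | true  = let (_ , _ , centre , P) = deg≡1⇒tip (isTip⇒deg≡1 tip-b)
                          in *-monoˡ-≤ 0≤1 (subst (λ t → load t b ≤ 2Δ+1) (sym (PendantPath.leaf P a (trans (A-sym b a) a~b)))
                                                  (subst (_≤ 2Δ+1) (load-comm b _) (OnLeg.load-leg≤ centre P)))
  ...   | false | false = ℚₚ.≤-reflexive (trans (ℚₚ.*-zeroˡ (load a b)) (sym (ℚₚ.*-zeroˡ 2Δ+1)))

  bound≤total-x₀ : bound Δ G ≤ total G x₀
  bound≤total-x₀ = *-cancelˡ-≤ (ℕ→ℚ-pos (Δ ℕ.+ Δ)) (*-cancelˡ-≤ 0<2 (begin
    2ℚ * (2Δ+1 * bound Δ G)                              ≡⟨ ∑-arcs-w*2 ⟨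
    ∑-arcs (λ u _ → w u * 2ℚ)                            ≡⟨ ∑∑-cong tight ⟨
    ∑-arcs (λ u v → w u * ∑-arcs (δ-weight x₀ u v))      ≡⟨ exchange x₀ ⟩
    ∑-arcs (λ a b → weight x₀ a b * load a b)            ≤⟨ ∑∑-mono-≤ x₀-load-term-≤ ⟩
    ∑-arcs (λ a b → weight x₀ a b * 2Δ+1)                ≡⟨ ∑-arcs-weight-* x₀ 2Δ+1 ⟩
    2ℚ * (2Δ+1 * total G x₀)                             ∎))
    where
    open ℚₚ.≤-Reasoning
    tight : ∀ u v → arc (λ u v → w u * ∑-arcs (δ-weight x₀ u v)) u v ≡ arc (λ u _ → w u * 2ℚ) u v
    tight u v with A u v in u~v
    ... | true  = cong (w u *_) (δ-x₀≡2 u~v)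
    ... | false = refl


open import Data.Nat using (_≤_)
open import Data.Rational using () renaming (_≤_ to _≤ℚ_)
open import Function.Bundles using (_⇔_; mk⇔)

theorem1 : (Δ : ℕ) → 1 ≤ Δ → (G : Graph) → MaxDegAtMost G Δ → NoSmallComponent G →
    (r : ℚ) → IsFracIndMatchingNumber G r →
      (r ≤ℚ bound Δ G) × (r ≡ bound Δ G ⇔ AllComponentsTstar Δ G)
theorem1 Δ _ G max-deg no-small r ((x , feasible , total≡r) , optimal) = r≤bound , mk⇔ equality⇒tstar tstar⇒equality
  where
  open UpperBound G Δ max-deg no-small using (total≤bound)
  open SpidersAreTStars G Δ using (spider⇒tstar; tstar⇒spider)

  r≤bound : r ≤ℚ bound Δ G
  r≤bound = subst (_≤ℚ bound Δ G) total≡r (total≤bound x feasible)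

  equality⇒tstar : r ≡ bound Δ G → AllComponentsTstar Δ G
  equality⇒tstar r≡bound = spider⇒tstar (EqualityCase.spider-cover G Δ max-deg no-small x feasible (trans total≡r r≡bound))

  tstar⇒equality : AllComponentsTstar Δ G → r ≡ bound Δ G
  tstar⇒equality all-tstar = ℚₚ.≤-antisym r≤bound (ℚₚ.≤-trans bound≤total-x₀ (optimal x₀ x₀-feasible))
    where open PendantWeighting G Δ max-deg no-small (tstar⇒spider all-tstar)
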